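{- LTL $<$ LTL[REG] $<$ LTL[VPL] $<$ LTL[DPDA] with respect to expressive power over Kripke transition systems.
   Context: Fix a finite set $AP$ of atomic propositions and a finite set $\Sigma$ of actions (a pushdown alphabet $\Sigma_{call}\uplus\Sigma_{int}\uplus\Sigma_{ret}$ where visibly pushdown automata are involved). A KTS is $\mathcal{K}=(S,\rightarrow,\lambda)$, $\rightarrow\subseteq S\times\Sigma\times S$, $\lambda:S\to2^{AP}$, initial state $s_0$, every state having a successor. Paths: $\pi=s_0a_0s_1a_1\dots$ with $(s_i,a_i,s_{i+1})\in\rightarrow$; $\pi^i=s_ia_is_{i+1}\dots$, $\pi(i)=s_i$, $Actions(\pi,n)=a_0\dots a_n$. For a class $U$ of finite-word automata over $\Sigma$, LTL[U]: $\varphi::=ap\mid\neg\varphi\mid\varphi\land\varphi\mid\varphi\,\mathcal{U}^{\mathcal{A}}\varphi$ ($\mathcal{A}\in U$); $\pi\models ap$ iff $ap\in\lambda(\pi(0))$; Boolean connectives as usual; $\pi\models\varphi_1\mathcal{U}^{\mathcal{A}}\varphi_2$ iff $\exists k$: $\pi^k\models\varphi_2$, $\forall j<k:\pi^j\models\varphi_1$, $Actions(\pi,k)\in\mathcal{L}(\mathcal{A})$. $\mathcal{K}\models\varphi$ iff all paths from $s_0$ satisfy $\varphi$. LTL is ordinary linear temporal logic (modalities next and until, interpreted on the sequence of state labels). LTL[REG], LTL[VPL], LTL[DPDA] take $U$ to be finite automata, visibly pushdown automata, and deterministic pushdown automata (on finite words, accepting by final state) respectively. For logics $L,L'$, $L\le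 L'$ iff for every formula $\varphi$ of $L$ there is a formula $\varphi'$ of $L'$ with $\mathcal{K}\models\varphi\Leftrightarrow\mathcal{K}\models\varphi'$ for all KTS $\mathcal{K}$; $L<L'$ iff $L\le L'$ and not $L'\le L$. -}

module Defs where

open import Level using (0ℓ)
open import Data.Nat using (ℕ; zero; suc; _+_; _<_)
open import Data.Fin using (Fin)
open import Data.Bool using (Bool; true)
open import Data.Sum using (_⊎_; inj₁; inj₂)
open import Data.Product using (Σ; ∃; _×_; _,_; ∃-syntax)
open import Data.List using (List; []; _∷_; map; _++_; upTo)
open import Data.Maybe using (Maybe; just; nothing)
open import Relation.Nullary using (¬_)
open import Relation.Binary.PropositionalEquality using (_≡_; _≢_)
open import Function.Bundles using (_⇔_)

record PAlph : Set where
  field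
    ncall nint nret : ℕ

open PAlph public

Act : PAlph → Set
Act P = Fin (ncall P) ⊎ (Fin (nint P) ⊎ Fin (nret P))

record KTS (AP A : Set) : Set₁ where
  field
    S      : Set
    _⟶[_]_ : S → A → S → Set
    label  : S → AP → Bool
    s₀     : S
    total  : ∀ s → ∃[ a ] ∃[ s' ] (s ⟶[ a ] s')

open KTS public

record Path {AP A : Set} (K : KTS AP A) : Set where
  field
    st   : ℕ → S K
    act  : ℕ → A
    step : ∀ i → _⟶[_]_ K (st i) (act i) (st (suc i))

open Path public

_↑_ : ∀ {AP A} {K : KTS AP A} → Path K → ℕ → Path K
st   (π ↑ k) i = st π (i + k)
act  (π ↑ k) i = act π (i + k)
step (π ↑ k) i = step π (i + k)

Actions : ∀ {AP A} {K : KTS AP A} → Path K → ℕ → List A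
Actions π k = map (act π) (upTo (suc k))

record Logic (AP A : Set) : Set₂ where
  field
    Form : Set
    _⊨ₚ_ : ∀ {K : KTS AP A} → Path K → Form → Set

open Logic public

_⊨[_]_ : ∀ {AP A} → KTS AP A → (L : Logic AP A) → Form L → Set
K ⊨[ L ] φ = (π : Path K) → st π 0 ≡ s₀ K → _⊨ₚ_ L π φ

_≤L_ : ∀ {AP A} → Logic AP A → Logic AP A → Set₁
L ≤L L' = (φ : Form L) → ∃[ φ' ] ((K : KTS _ _) → (K ⊨[ L ] φ) ⇔ (K ⊨[ L' ] φ'))

_<L_ : ∀ {AP A} → Logic AP A → Logic AP A → Set₁
L <L L' = (L ≤L L') × ¬ (L' ≤L L)

data LTLForm (AP : Set) : Set where
  atom : AP → LTLForm AP
  ¬ₗ   : LTLForm AP → LTLForm AP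
  _∧ₗ_ : LTLForm AP → LTLForm AP → LTLForm AP
  Xₗ   : LTLForm AP → LTLForm AP
  _Uₗ_ : LTLForm AP → LTLForm AP → LTLForm AP

satLTL : ∀ {AP A} {K : KTS AP A} → Path K → LTLForm AP → Set
satLTL {K = K} π (atom p) = label K (st π 0) p ≡ true
satLTL π (¬ₗ φ)   = ¬ satLTL π φ
satLTL π (φ ∧ₗ ψ) = satLTL π φ × satLTL π ψ
satLTL π (Xₗ φ)   = satLTL (π ↑ 1) φ
satLTL π (φ Uₗ ψ) = ∃[ k ] (satLTL (π ↑ k) ψ × (∀ j → j < k → satLTL (π ↑ j) φ))

LTL : (AP A : Set) → Logic AP A
LTL AP A = record { Form = LTLForm AP ; _⊨ₚ_ = satLTL }

data LTLUForm (AP Aut : Set) : Set where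
  atom  : AP → LTLUForm AP Aut
  ¬ᵤ    : LTLUForm AP Aut → LTLUForm AP Aut
  _∧ᵤ_  : LTLUForm AP Aut → LTLUForm AP Aut → LTLUForm AP Aut
  until : LTLUForm AP Aut → Aut → LTLUForm AP Aut → LTLUForm AP Aut

satU : ∀ {AP A Aut} (Lang : Aut → List A → Set) {K : KTS AP A} →
       Path K → LTLUForm AP Aut → Set
satU Lang {K} π (atom p) = label K (st π 0) p ≡ true
satU Lang π (¬ᵤ φ)   = ¬ satU Lang π φ
satU Lang π (φ ∧ᵤ ψ) = satU Lang π φ × satU Lang π ψ
satU Lang π (until φ 𝒜 ψ) =
  ∃[ k ] (satU Lang (π ↑ k) ψ × (∀ j → j < k → satU Lang (π ↑ j) φ)
          × Lang 𝒜 (Actions π k))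

LTL[_] : ∀ {AP A Aut} → (Aut → List A → Set) → Logic AP A
LTL[_] {AP} {A} {Aut} Lang = record { Form = LTLUForm AP Aut ; _⊨ₚ_ = satU Lang }

record NFA (A : Set) : Set where
  field
    nQ    : ℕ
    init  : Fin nQ → Bool
    δ     : Fin nQ → A → Fin nQ → Bool
    final : Fin nQ → Bool

data NFARun {A : Set} (M : NFA A) : Fin (NFA.nQ M) → List A → Fin (NFA.nQ M) → Set where
  nil  : ∀ {q} → NFARun M q [] q
  cons : ∀ {q a q' w q''} → NFA.δ M q a q' ≡ true → NFARun M q' w q'' →
         NFARun M q (a ∷ w) q''

NFAAccepts : ∀ {A} → NFA A → List A → Set
NFAAccepts M w = ∃[ q ] ∃[ q' ] (NFA.init M q ≡ true × NFARun M q w q' × NFA.final M q' ≡ true)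

-- Visibly pushdown automata (Alur–Madhusudan), acceptance by final state.
-- Stack symbols Fin nΓ; 'nothing' plays the role of the bottom symbol ⊥.

record VPA (P : PAlph) : Set where
  field
    nQ nΓ : ℕ
    init  : Fin nQ → Bool
    final : Fin nQ → Bool
    δc    : Fin nQ → Fin (ncall P) → Fin nQ → Fin nΓ → Bool
    δi    : Fin nQ → Fin (nint P) → Fin nQ → Bool
    δr    : Fin nQ → Fin (nret P) → Maybe (Fin nΓ) → Fin nQ → Bool

module _ {P : PAlph} (M : VPA P) where
  open VPA M
  data VPARun : Fin nQ → List (Fin nΓ) → List (Act P) → Fin nQ → List (Fin nΓ) → Set where
    nil    : ∀ {q σ} → VPARun q σ [] q σ
    call   : ∀ {q c q' γ σ w q'' σ''} → δc q c q' γ ≡ true →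
             VPARun q' (γ ∷ σ) w q'' σ'' → VPARun q σ (inj₁ c ∷ w) q'' σ''
    int    : ∀ {q a q' σ w q'' σ''} → δi q a q' ≡ true →
             VPARun q' σ w q'' σ'' → VPARun q σ (inj₂ (inj₁ a) ∷ w) q'' σ''
    retPop : ∀ {q r γ q' σ w q'' σ''} → δr q r (just γ) q' ≡ true →
             VPARun q' σ w q'' σ'' → VPARun q (γ ∷ σ) (inj₂ (inj₂ r) ∷ w) q'' σ''
    retBot : ∀ {q r q' w q'' σ''} → δr q r nothing q' ≡ true →
             VPARun q' [] w q'' σ'' → VPARun q [] (inj₂ (inj₂ r) ∷ w) q'' σ''

VPAAccepts : ∀ {P} → VPA P → List (Act P) → Set
VPAAccepts M w = ∃[ q₀ ] ∃[ q ] ∃[ σ ]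
  (VPA.init M q₀ ≡ true × VPARun M q₀ [] w q σ × VPA.final M q ≡ true)

-- Deterministic pushdown automata, acceptance by final state.
-- δ q nothing X is an ε-move.

record DPDA (A : Set) : Set where
  field
    nQ nΓ : ℕ
    q₀    : Fin nQ
    Z₀    : Fin nΓ
    final : Fin nQ → Bool
    δ     : Fin nQ → Maybe A → Fin nΓ → Maybe (Fin nQ × List (Fin nΓ))
    det   : ∀ q X → δ q nothing X ≢ nothing → ∀ a → δ q (just a) X ≡ nothing

module _ {A : Set} (M : DPDA A) where
  open DPDA M
  data DPDARun : Fin nQ → List A → List (Fin nΓ) → Fin nQ → List (Fin nΓ) → Set where
    nil  : ∀ {q σ} → DPDARun q [] σ q σ
    eps  : ∀ {q X σ q' α w q'' σ''} → δ q nothing X ≡ just (q' , α) →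
           DPDARun q' w (α ++ σ) q'' σ'' → DPDARun q w (X ∷ σ) q'' σ''
    read : ∀ {q a X σ q' α w q'' σ''} → δ q (just a) X ≡ just (q' , α) →
           DPDARun q' w (α ++ σ) q'' σ'' → DPDARun q (a ∷ w) (X ∷ σ) q'' σ''

DPDAAccepts : ∀ {A} → DPDA A → List A → Set
DPDAAccepts M w = ∃[ q ] ∃[ σ ]
  (DPDARun M (DPDA.q₀ M) w (DPDA.Z₀ M ∷ []) q σ × DPDA.final M q ≡ true)

LTLₗ : (nAP : ℕ) (P : PAlph) → Logic (Fin nAP) (Act P)
LTLₗ nAP P = LTL (Fin nAP) (Act P)

LTL[REG] : (nAP : ℕ) (P : PAlph) → Logic (Fin nAP) (Act P)
LTL[REG] nAP P = LTL[ NFAAccepts {Act P} ]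

LTL[VPL] : (nAP : ℕ) (P : PAlph) → Logic (Fin nAP) (Act P)
LTL[VPL] nAP P = LTL[ VPAAccepts {P} ]

LTL[DPDA] : (nAP : ℕ) (P : PAlph) → Logic (Fin nAP) (Act P)
LTL[DPDA] nAP P = LTL[ DPDAAccepts {Act P} ]

-- Each inclusion L ≤ L' is a satisfaction-preserving translation of formulas:
-- plain LTL goes into LTL[REG] via  X φ = ⊤ U^{Σ²} φ  and  φ U ψ = φ U^{Σ*} ψ;
-- the other two replace every automaton by an equivalent one (an NFA is a VPA
-- ignoring its stack; a VPA is determinized by the summary construction of
-- Alur and Madhusudan into a machine that is a DPDA without ε-moves).
--
-- Each strictness L' ≰ L exhibits a formula of L' separating two systems that
-- no formula of L can separate.  LTL only sees labels, so it cannot tell a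
-- call loop from an internal loop, which "the first action is a call" does.
-- For the other two we pump a prefix letter x: if every automaton of L has an
-- ultimately periodic language on the words x^b u (NFAs always; VPAs when x
-- is a return read on the empty stack), then every formula of L is
-- ultimately periodic on the words x^a t (the until case being the heart of
-- the argument), whereas "some prefix lies in { x^n y^n z }" is not; the
-- latter language is recognised by a VPA (x a call, y a return) and by a DPDA
-- (x a return, y a call) respectively.
module Submission where

open import Defs
open import Data.Nat using (ℕ; zero; suc; _+_; _*_; _^_; _<_; _≤_; z≤n; s≤s; _<?_; _≤?_)
open import Data.Nat.Properties hiding (_≟_)
open import Data.Nat.Divisibility using (_∣_; divides; ∣-trans; ∣-refl; m∣m*n; n∣m*n)
open import Data.Nat.Tactic.RingSolver using (solve-∀)
open import Data.Fin using (Fin; zero; suc; toℕ; fromℕ<; combine; remQuot; funToFin; finToFun; _≟_)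
open import Data.Fin.Properties using (2↔Bool; finToFun-funToFin; remQuot-combine; pigeonhole)
open import Data.Bool using (Bool; true; false; _∧_; _∨_)
open import Data.Unit using (⊤; tt)
open import Data.Empty using (⊥; ⊥-elim)
open import Data.Sum using (_⊎_; inj₁; inj₂)
open import Data.Maybe using (Maybe; just; nothing)
open import Data.Product using (_×_; _,_; ∃-syntax; proj₁; proj₂)
open import Data.Product.Function.NonDependent.Propositional using (_×-⇔_)
open import Data.List using (List; []; _∷_; _++_; upTo; applyUpTo; length; replicate)
open import Data.List.Properties using (map-applyUpTo; length-applyUpTo; map-cong; ++-identityʳ)
open import Relation.Nullary using (¬_; yes; no; does)
open import Relation.Nullary.Decidable using (dec-true)
open import Relation.Binary.PropositionalEquality
open import Function using (id; _∘_)
open import Function.Bundles using (Inverse; _⇔_; mk⇔; Equivalence)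
open import Function.Related.TypeIsomorphisms using (¬-cong-⇔)
import Function.Properties.Equivalence as ⇔

Actions≡applyUpTo : ∀ {AP A} {K : KTS AP A} (π : Path K) k →
                    Actions π k ≡ applyUpTo (act π) (suc k)
Actions≡applyUpTo π k = map-applyUpTo id (act π) (suc k)

length-Actions : ∀ {AP A} {K : KTS AP A} (π : Path K) k → length (Actions π k) ≡ suc k
length-Actions π k = trans (cong length (Actions≡applyUpTo π k)) (length-applyUpTo (act π) (suc k))

record SameLabels {AP A : Set} {K K' : KTS AP A} (π : Path K) (π' : Path K') : Set where
  constructor sameLabels
  field labels : ∀ i p → label K (st π i) p ≡ label K' (st π' i) p
open SameLabels

record Agree {AP A : Set} {K K' : KTS AP A} (π : Path K) (π' : Path K') : Set where
  constructor agree
  field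
    agreeLabels  : SameLabels π π'
    agreeActions : ∀ i → act π i ≡ act π' i
open Agree

module _ {AP A : Set} {K K' : KTS AP A} {π : Path K} {π' : Path K'} where
  sameLabels-sym : SameLabels π π' → SameLabels π' π
  sameLabels-sym (sameLabels h) = sameLabels λ i p → sym (h i p)

  sameLabels-↑ : SameLabels π π' → ∀ k → SameLabels (π ↑ k) (π' ↑ k)
  sameLabels-↑ (sameLabels h) k = sameLabels λ i → h (i + k)

  agree-sym : Agree π π' → Agree π' π
  agree-sym (agree hl ha) = agree (sameLabels-sym hl) λ i → sym (ha i)

  agree-↑ : Agree π π' → ∀ k → Agree (π ↑ k) (π' ↑ k)
  agree-↑ (agree hl ha) k = agree (sameLabels-↑ hl k) λ i → ha (i + k)

satLTL-transfer : ∀ {AP A} {K K' : KTS AP A} {π : Path K} {π' : Path K'} →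
                  SameLabels π π' → ∀ φ → satLTL π φ → satLTL π' φ
satLTL-transfer h (atom p) s = trans (sym (labels h 0 p)) s
satLTL-transfer h (¬ₗ φ) s s' = s (satLTL-transfer (sameLabels-sym h) φ s')
satLTL-transfer h (φ ∧ₗ ψ) (s , s') = satLTL-transfer h φ s , satLTL-transfer h ψ s'
satLTL-transfer h (Xₗ φ) s = satLTL-transfer (sameLabels-↑ h 1) φ s
satLTL-transfer h (φ Uₗ ψ) (k , s , u) =
  k , satLTL-transfer (sameLabels-↑ h k) ψ s , λ j j<k → satLTL-transfer (sameLabels-↑ h j) φ (u j j<k)

satU-transfer : ∀ {AP A Aut} (Lang : Aut → List A → Set) {K K' : KTS AP A}
                {π : Path K} {π' : Path K'} → Agree π π' → ∀ φ → satU Lang π φ → satU Lang π' φ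
satU-transfer Lang h (atom p) s = trans (sym (labels (agreeLabels h) 0 p)) s
satU-transfer Lang h (¬ᵤ φ) s s' = s (satU-transfer Lang (agree-sym h) φ s')
satU-transfer Lang h (φ ∧ᵤ ψ) (s , s') = satU-transfer Lang h φ s , satU-transfer Lang h ψ s'
satU-transfer Lang h (until φ 𝒜 ψ) (k , s , u , l) =
  k , satU-transfer Lang (agree-↑ h k) ψ s , (λ j j<k → satU-transfer Lang (agree-↑ h j) φ (u j j<k)) ,
  subst (Lang 𝒜) (map-cong (agreeActions h) (upTo (suc k))) l

≤L-by-translation : ∀ {AP A} {L L' : Logic AP A} (tr : Form L → Form L') →
  (∀ {K : KTS AP A} (π : Path K) φ → (_⊨ₚ_ L π φ) ⇔ (_⊨ₚ_ L' π (tr φ))) → L ≤L L'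
≤L-by-translation tr ok φ = tr φ , λ K →
  mk⇔ (λ h π e → Equivalence.to (ok π φ) (h π e)) (λ h π e → Equivalence.from (ok π φ) (h π e))

not-≤L : ∀ {AP A} {L L' : Logic AP A} (φ : Form L') →
  (∀ ψ → ∃[ K ] ∃[ K' ] ((K ⊨[ L ] ψ → K' ⊨[ L ] ψ) × K ⊨[ L' ] φ × ¬ (K' ⊨[ L' ] φ))) →
  ¬ (L' ≤L L)
not-≤L φ sep L'≤L with L'≤L φ
... | ψ , ψ≡φ with sep ψ
... | K , K' , ψ-transfers , K⊨φ , K'⊭φ =
  K'⊭φ (Equivalence.from (ψ≡φ K') (ψ-transfers (Equivalence.to (ψ≡φ K) K⊨φ)))

module LanguageTranslation {AP A Aut Aut' : Set}
         (Lang : Aut → List A → Set) (Lang' : Aut' → List A → Set)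
         (τ : Aut → Aut') (τ-sound : ∀ 𝒜 w → Lang 𝒜 w ⇔ Lang' (τ 𝒜) w) where

  translate : LTLUForm AP Aut → LTLUForm AP Aut'
  translate (atom p)      = atom p
  translate (¬ᵤ φ)        = ¬ᵤ (translate φ)
  translate (φ ∧ᵤ ψ)      = translate φ ∧ᵤ translate ψ
  translate (until φ 𝒜 ψ) = until (translate φ) (τ 𝒜) (translate ψ)

  translate-sat : ∀ {K : KTS AP A} (π : Path K) φ → satU Lang π φ ⇔ satU Lang' π (translate φ)
  translate-sat π (atom p)      = mk⇔ id id
  translate-sat π (¬ᵤ φ)        = ¬-cong-⇔ (translate-sat π φ)
  translate-sat π (φ ∧ᵤ ψ)      = translate-sat π φ ×-⇔ translate-sat π ψ
  translate-sat π (until φ 𝒜 ψ) = mk⇔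
    (λ (k , s , u , l) → k , Equivalence.to (translate-sat (π ↑ k) ψ) s ,
        (λ j j<k → Equivalence.to (translate-sat (π ↑ j) φ) (u j j<k)) , Equivalence.to (τ-sound 𝒜 _) l)
    (λ (k , s , u , l) → k , Equivalence.from (translate-sat (π ↑ k) ψ) s ,
        (λ j j<k → Equivalence.from (translate-sat (π ↑ j) φ) (u j j<k)) , Equivalence.from (τ-sound 𝒜 _) l)

  ≤-by-automata : LTL[_] {AP} Lang ≤L LTL[_] {AP} Lang'
  ≤-by-automata = ≤L-by-translation translate translate-sat

-- A tautology, available as soon as there is one atomic proposition.
⊤ᵤ : ∀ {AP Aut} → AP → LTLUForm AP Aut
⊤ᵤ p = ¬ᵤ (atom p ∧ᵤ ¬ᵤ (atom p))

⊤ᵤ-sat : ∀ {AP A Aut} (Lang : Aut → List A → Set) {K : KTS AP A} (π : Path K) p →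
         satU Lang π (⊤ᵤ p)
⊤ᵤ-sat Lang π p (s , ¬s) = ¬s s

allWordsNFA : ∀ {A} → NFA A
allWordsNFA = record { nQ = 1 ; init = λ _ → true ; δ = λ _ _ _ → true ; final = λ _ → true }

allWords-accepts : ∀ {A} (w : List A) → NFAAccepts allWordsNFA w
allWords-accepts w = zero , zero , refl , run w , refl
  where
  run : ∀ w → NFARun allWordsNFA zero w zero
  run []      = nil
  run (a ∷ w) = cons refl (run w)

twoLettersNFA : ∀ {A} → NFA A
twoLettersNFA = record
  { nQ = 3 ; init = λ { zero → true ; _ → false } ; δ = count ; final = λ { (suc (suc zero)) → true ; _ → false } }
  where
  count : Fin 3 → _ → Fin 3 → Bool
  count zero       _ (suc zero)       = true
  count (suc zero) _ (suc (suc zero)) = true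
  count _          _ _                = false

twoLetters-length : ∀ {A} {w : List A} → NFAAccepts twoLettersNFA w → length w ≡ 2
twoLetters-length {A} (zero , q , _ , r , f) = from0 r f
  where
  from2 : ∀ {w q} → NFARun (twoLettersNFA {A}) (suc (suc zero)) w q → NFA.final (twoLettersNFA {A}) q ≡ true → length w ≡ 0
  from2 nil _ = refl
  from2 (cons {q' = zero} () _) _
  from2 (cons {q' = suc zero} () _) _
  from2 (cons {q' = suc (suc zero)} () _) _
  from1 : ∀ {w q} → NFARun (twoLettersNFA {A}) (suc zero) w q → NFA.final (twoLettersNFA {A}) q ≡ true → length w ≡ 1
  from1 nil ()
  from1 (cons {q' = zero} () _) _
  from1 (cons {q' = suc zero} () _) _
  from1 (cons {q' = suc (suc zero)} _ r) f = cong suc (from2 r f)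
  from0 : ∀ {w q} → NFARun (twoLettersNFA {A}) zero w q → NFA.final (twoLettersNFA {A}) q ≡ true → length w ≡ 2
  from0 nil ()
  from0 (cons {q' = zero} () _) _
  from0 (cons {q' = suc zero} _ r) f = cong suc (from1 r f)
  from0 (cons {q' = suc (suc zero)} () _) _
twoLetters-length (suc zero , _ , () , _)
twoLetters-length (suc (suc zero) , _ , () , _)

twoLetters-accepts : ∀ {A} (a b : A) → NFAAccepts twoLettersNFA (a ∷ b ∷ [])
twoLetters-accepts a b = zero , suc (suc zero) , refl , cons {q' = suc zero} refl (cons refl nil) , refl

module LTL-into-REG {nAP : ℕ} {P : PAlph} (p₀ : Fin nAP) where

  fromLTL : LTLForm (Fin nAP) → LTLUForm (Fin nAP) (NFA (Act P))
  fromLTL (atom p) = atom p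
  fromLTL (¬ₗ φ)   = ¬ᵤ (fromLTL φ)
  fromLTL (φ ∧ₗ ψ) = fromLTL φ ∧ᵤ fromLTL ψ
  fromLTL (Xₗ φ)   = until (⊤ᵤ p₀) twoLettersNFA (fromLTL φ)
  fromLTL (φ Uₗ ψ) = until (fromLTL φ) allWordsNFA (fromLTL ψ)

  fromLTL-sat : ∀ {K : KTS (Fin nAP) (Act P)} (π : Path K) φ → satLTL π φ ⇔ satU NFAAccepts π (fromLTL φ)
  fromLTL-sat π (atom p) = mk⇔ id id
  fromLTL-sat π (¬ₗ φ)   = ¬-cong-⇔ (fromLTL-sat π φ)
  fromLTL-sat π (φ ∧ₗ ψ) = fromLTL-sat π φ ×-⇔ fromLTL-sat π ψ
  fromLTL-sat π (Xₗ φ)   = mk⇔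
    (λ s → 1 , Equivalence.to (fromLTL-sat (π ↑ 1) φ) s , ⊤-before-1 , twoLetters-accepts _ _)
    (λ (k , s , _ , l) → next-at k s (trans (sym (length-Actions π k)) (twoLetters-length l)))
    where
    ⊤-before-1 : ∀ j → j < 1 → satU NFAAccepts (π ↑ j) (⊤ᵤ p₀)
    ⊤-before-1 j _ = ⊤ᵤ-sat NFAAccepts (π ↑ j) p₀
    -- the Σ²-constraint forces the witness position to be 1
    next-at : ∀ k → satU NFAAccepts (π ↑ k) (fromLTL φ) → suc k ≡ 2 → satLTL (π ↑ 1) φ
    next-at .1 s refl = Equivalence.from (fromLTL-sat (π ↑ 1) φ) s
  fromLTL-sat π (φ Uₗ ψ) = mk⇔
    (λ (k , s , u) → k , Equivalence.to (fromLTL-sat (π ↑ k) ψ) s ,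
        (λ j j<k → Equivalence.to (fromLTL-sat (π ↑ j) φ) (u j j<k)) , allWords-accepts _)
    (λ (k , s , u , _) → k , Equivalence.from (fromLTL-sat (π ↑ k) ψ) s ,
        (λ j j<k → Equivalence.from (fromLTL-sat (π ↑ j) φ) (u j j<k)))

  LTL≤REG : LTLₗ nAP P ≤L LTL[REG] nAP P
  LTL≤REG = ≤L-by-translation fromLTL fromLTL-sat

loopKTS : ∀ {AP A : Set} → A → KTS AP A
loopKTS x = record
  { S = ⊤ ; _⟶[_]_ = λ _ a _ → a ≡ x ; label = λ _ _ → false ; s₀ = tt ; total = λ _ → x , tt , refl }

loopPath : ∀ {AP A : Set} (x : A) → Path (loopKTS {AP} x)
loopPath x = record { st = λ _ → tt ; act = λ _ → x ; step = λ _ → refl }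

-- Plain LTL only observes labels, so it cannot tell two such loops apart.
loop-LTL-blind : ∀ {AP A : Set} (x y : A) φ →
  loopKTS x ⊨[ LTL AP A ] φ → loopKTS y ⊨[ LTL AP A ] φ
loop-LTL-blind x y φ x⊨φ π _ = satLTL-transfer (sameLabels λ _ _ → refl) φ (x⊨φ (loopPath x) refl)

firstCallNFA : ∀ {P} → NFA (Act P)
firstCallNFA = record
  { nQ = 2 ; init = λ { zero → true ; _ → false } ; δ = afterCall ; final = λ { (suc zero) → true ; _ → false } }
  where
  afterCall : Fin 2 → Act _ → Fin 2 → Bool
  afterCall zero       (inj₁ _) (suc zero) = true
  afterCall (suc zero) _        (suc zero) = true
  afterCall _          _        _          = false

firstCall-rejects : ∀ {P} b (w : List (Act P)) → ¬ NFAAccepts firstCallNFA (inj₂ b ∷ w)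
firstCall-rejects b w (zero , _ , _ , cons {q' = zero} () _ , _)
firstCall-rejects b w (zero , _ , _ , cons {q' = suc zero} () _ , _)
firstCall-rejects b w (suc zero , _ , () , _)

REG≰LTL : ∀ {nAP P} → Fin nAP → Fin (ncall P) → Fin (nint P) → ¬ (LTL[REG] nAP P ≤L LTLₗ nAP P)
REG≰LTL {nAP} {P} p₀ c i = not-≤L firstCall λ ψ →
  loopKTS (inj₁ c) , loopKTS (inj₂ (inj₁ i)) , loop-LTL-blind _ _ ψ , call-loop⊨ , internal-loop⊭
  where
  firstCall : LTLUForm (Fin nAP) (NFA (Act P))
  firstCall = until (⊤ᵤ p₀) firstCallNFA (⊤ᵤ p₀)
  call-loop⊨ : loopKTS (inj₁ c) ⊨[ LTL[REG] nAP P ] firstCall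
  call-loop⊨ π _ = 0 , ⊤ᵤ-sat NFAAccepts (π ↑ 0) p₀ , (λ _ ()) ,
    subst (λ a → NFAAccepts firstCallNFA (a ∷ [])) (sym (step π 0)) (zero , suc zero , refl , cons refl nil , refl)
  internal-loop⊭ : ¬ (loopKTS (inj₂ (inj₁ i)) ⊨[ LTL[REG] nAP P ] firstCall)
  internal-loop⊭ h with h (loopPath _) refl
  ... | _ , _ , _ , l = firstCall-rejects _ _ l

-- LTL[REG] ≤ LTL[VPL]: an NFA is a VPA that pushes a dummy symbol on calls
-- and ignores the stack on returns.
module NFA-as-VPA {P : PAlph} (N : NFA (Act P)) where

  asVPA : VPA P
  asVPA = record
    { nQ = NFA.nQ N ; nΓ = 1 ; init = NFA.init N ; final = NFA.final N
    ; δc = λ q c q' _ → NFA.δ N q (inj₁ c) q'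
    ; δi = λ q a q' → NFA.δ N q (inj₂ (inj₁ a)) q'
    ; δr = λ q r _ q' → NFA.δ N q (inj₂ (inj₂ r)) q' }

  run→VPARun : ∀ {q w q'} → NFARun N q w q' → ∀ σ → ∃[ σ' ] VPARun asVPA q σ w q' σ'
  run→VPARun nil σ = σ , nil
  run→VPARun (cons {a = inj₁ c} e r) σ = let σ' , r' = run→VPARun r (zero ∷ σ) in σ' , call e r'
  run→VPARun (cons {a = inj₂ (inj₁ a)} e r) σ = let σ' , r' = run→VPARun r σ in σ' , int e r'
  run→VPARun (cons {a = inj₂ (inj₂ a)} e r) [] = let σ' , r' = run→VPARun r [] in σ' , retBot e r'
  run→VPARun (cons {a = inj₂ (inj₂ a)} e r) (γ ∷ σ) = let σ' , r' = run→VPARun r σ in σ' , retPop e r'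

  VPARun→run : ∀ {q σ w q' σ'} → VPARun asVPA q σ w q' σ' → NFARun N q w q'
  VPARun→run nil          = nil
  VPARun→run (call e r)   = cons e (VPARun→run r)
  VPARun→run (int e r)    = cons e (VPARun→run r)
  VPARun→run (retPop e r) = cons e (VPARun→run r)
  VPARun→run (retBot e r) = cons e (VPARun→run r)

  asVPA-sound : ∀ w → NFAAccepts N w ⇔ VPAAccepts asVPA w
  asVPA-sound w = mk⇔
    (λ (q , q' , i , r , f) → let σ , r' = run→VPARun r [] in q , q' , σ , i , r' , f)
    (λ (q , q' , σ , i , r , f) → q , q' , i , VPARun→run r , f)

REG≤VPL : ∀ nAP P → LTL[REG] nAP P ≤L LTL[VPL] nAP P
REG≤VPL nAP P = LanguageTranslation.≤-by-automata NFAAccepts VPAAccepts NFA-as-VPA.asVPA NFA-as-VPA.asVPA-sound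

anyFin : ∀ {n} → (Fin n → Bool) → Bool
anyFin {zero}  f = false
anyFin {suc n} f = f zero ∨ anyFin (f ∘ suc)

anyFin-intro : ∀ {n} (f : Fin n → Bool) i → f i ≡ true → anyFin f ≡ true
anyFin-intro f zero    e rewrite e = refl
anyFin-intro f (suc i) e with f zero
... | true  = refl
... | false = anyFin-intro (f ∘ suc) i e

anyFin-elim : ∀ {n} (f : Fin n → Bool) → anyFin f ≡ true → ∃[ i ] (f i ≡ true)
anyFin-elim {suc n} f e with f zero in f0
... | true  = zero , f0
... | false = let i , fi = anyFin-elim (f ∘ suc) e in suc i , fi

anyFin-cong : ∀ {n} {f g : Fin n → Bool} → (∀ i → f i ≡ g i) → anyFin f ≡ anyFin g
anyFin-cong {zero}  h = refl
anyFin-cong {suc n} h = cong₂ _∨_ (h zero) (anyFin-cong (h ∘ suc))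

∧-intro : ∀ {a b} → a ≡ true → b ≡ true → a ∧ b ≡ true
∧-intro refl refl = refl

∧-elim : ∀ {a b} → a ∧ b ≡ true → a ≡ true × b ≡ true
∧-elim {true} {true} _ = refl , refl

idRel : ∀ {n} → Fin n → Fin n → Bool
idRel p q = does (p ≟ q)

idRel-refl : ∀ {n} (q : Fin n) → idRel q q ≡ true
idRel-refl q = dec-true (q ≟ q) refl

idRel⇒≡ : ∀ {n} {p q : Fin n} → idRel p q ≡ true → p ≡ q
idRel⇒≡ {p = p} {q} e with p ≟ q
... | yes p≡q = p≡q

-- Boolean predicates on Fin k, and Boolean relations on Fin n, are finitely
-- many; they are coded by elements of Fin (2 ^ k), resp. Fin (2 ^ (n * n)).
codePred : ∀ {k} → (Fin k → Bool) → Fin (2 ^ k)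
codePred f = funToFin (Inverse.from 2↔Bool ∘ f)

decodePred : ∀ {k} → Fin (2 ^ k) → Fin k → Bool
decodePred c i = Inverse.to 2↔Bool (finToFun c i)

decode-codePred : ∀ {k} (f : Fin k → Bool) i → decodePred (codePred f) i ≡ f i
decode-codePred f i =
  trans (cong (Inverse.to 2↔Bool) (finToFun-funToFin (Inverse.from 2↔Bool ∘ f) i))
        (Inverse.strictlyInverseˡ 2↔Bool (f i))

codeRel : ∀ {n} → (Fin n → Fin n → Bool) → Fin (2 ^ (n * n))
codeRel {n} S = codePred λ ι → S (proj₁ (remQuot {n} n ι)) (proj₂ (remQuot {n} n ι))

decodeRel : ∀ {n} → Fin (2 ^ (n * n)) → Fin n → Fin n → Bool
decodeRel {n} c p q = decodePred c (combine {n} {n} p q)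

decode-codeRel : ∀ {n} (S : Fin n → Fin n → Bool) p q → decodeRel (codeRel S) p q ≡ S p q
decode-codeRel {n} S p q =
  trans (decode-codePred _ (combine {n} {n} p q))
        (cong (λ pq → S (proj₁ pq) (proj₂ pq)) (remQuot-combine {n} p q))

-- A deterministic visibly pushdown machine: it reads one letter per step,
-- pushes exactly one frame on a call, pops one on a return (consulting
-- 'nothing' on an empty stack) and leaves the stack alone on internal letters.
record DVPA (P : PAlph) : Set where
  field
    nQ nF     : ℕ
    start     : Fin nQ
    onCall    : Fin nQ → Fin (ncall P) → Fin nQ × Fin nF
    onInt     : Fin nQ → Fin (nint P) → Fin nQ
    onRet     : Fin nQ → Maybe (Fin nF) → Fin (nret P) → Fin nQ
    accepting : Fin nQ → Bool

module DVPASemantics {P : PAlph} (D : DVPA P) where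
  open DVPA D

  Config : Set
  Config = Fin nQ × List (Fin nF)

  next : Config → Act P → Config
  next (q , fs)     (inj₁ c)         = proj₁ (onCall q c) , proj₂ (onCall q c) ∷ fs
  next (q , fs)     (inj₂ (inj₁ a))  = onInt q a , fs
  next (q , [])     (inj₂ (inj₂ r))  = onRet q nothing r , []
  next (q , f ∷ fs) (inj₂ (inj₂ r))  = onRet q (just f) r , fs

  run : Config → List (Act P) → Config
  run κ []      = κ
  run κ (a ∷ w) = run (next κ a) w

  DVPAAccepts : List (Act P) → Set
  DVPAAccepts w = accepting (proj₁ (run (start , []) w)) ≡ true

  -- The same machine as a DPDA without ε-moves: stack symbol 'suc f' is the
  -- frame f and 'zero' marks the bottom.
  stackOf : List (Fin nF) → List (Fin (suc nF))
  stackOf []       = zero ∷ []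
  stackOf (f ∷ fs) = suc f ∷ stackOf fs

  readLetter : Fin nQ → Act P → Fin (suc nF) → Maybe (Fin nQ × List (Fin (suc nF)))
  readLetter q (inj₁ c)        X       = just (proj₁ (onCall q c) , suc (proj₂ (onCall q c)) ∷ X ∷ [])
  readLetter q (inj₂ (inj₁ a)) X       = just (onInt q a , X ∷ [])
  readLetter q (inj₂ (inj₂ r)) zero    = just (onRet q nothing r , zero ∷ [])
  readLetter q (inj₂ (inj₂ r)) (suc f) = just (onRet q (just f) r , [])

  δD : Fin nQ → Maybe (Act P) → Fin (suc nF) → Maybe (Fin nQ × List (Fin (suc nF)))
  δD q nothing  X = nothing
  δD q (just a) X = readLetter q a X

  asDPDA : DPDA (Act P)
  asDPDA = record
    { nQ = nQ ; nΓ = suc nF ; q₀ = start ; Z₀ = zero ; final = accepting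
    ; δ = δD ; det = λ _ _ ε-move _ → ⊥-elim (ε-move refl) }

  asDPDA-run : ∀ w q fs → DPDARun asDPDA q w (stackOf fs) (proj₁ (run (q , fs) w)) (stackOf (proj₂ (run (q , fs) w)))
  asDPDA-run []                    q fs       = nil
  asDPDA-run (inj₁ c ∷ w)          q []       = read refl (asDPDA-run w _ _)
  asDPDA-run (inj₁ c ∷ w)          q (f ∷ fs) = read refl (asDPDA-run w _ _)
  asDPDA-run (inj₂ (inj₁ a) ∷ w)   q []       = read refl (asDPDA-run w _ _)
  asDPDA-run (inj₂ (inj₁ a) ∷ w)   q (f ∷ fs) = read refl (asDPDA-run w _ _)
  asDPDA-run (inj₂ (inj₂ r) ∷ w)   q []       = read refl (asDPDA-run w _ _)
  asDPDA-run (inj₂ (inj₂ r) ∷ w)   q (f ∷ fs) = read refl (asDPDA-run w _ _)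

  asDPDA-unique : ∀ w q fs {q' σ'} → DPDARun asDPDA q w (stackOf fs) q' σ' → q' ≡ proj₁ (run (q , fs) w)
  asDPDA-unique []                  q []       nil = refl
  asDPDA-unique []                  q (f ∷ fs) nil = refl
  asDPDA-unique w                   q []       (eps () _)
  asDPDA-unique w                   q (f ∷ fs) (eps () _)
  asDPDA-unique (inj₁ c ∷ w)        q []       (read refl r) = asDPDA-unique w _ _ r
  asDPDA-unique (inj₁ c ∷ w)        q (f ∷ fs) (read refl r) = asDPDA-unique w _ _ r
  asDPDA-unique (inj₂ (inj₁ a) ∷ w) q []       (read refl r) = asDPDA-unique w _ _ r
  asDPDA-unique (inj₂ (inj₁ a) ∷ w) q (f ∷ fs) (read refl r) = asDPDA-unique w _ _ r
  asDPDA-unique (inj₂ (inj₂ b) ∷ w) q []       (read refl r) = asDPDA-unique w _ _ r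
  asDPDA-unique (inj₂ (inj₂ b) ∷ w) q (f ∷ fs) (read refl r) = asDPDA-unique w _ _ r

  asDPDA-sound : ∀ w → DVPAAccepts w ⇔ DPDAAccepts asDPDA w
  asDPDA-sound w = mk⇔
    (λ acc → _ , _ , asDPDA-run w start [] , acc)
    (λ (q , σ , r , acc) → subst (λ q → accepting q ≡ true) (asDPDA-unique w start [] r) acc)

-- Determinization of VPAs (Alur–Madhusudan).  The deterministic machine keeps
-- a summary S ⊆ Q × Q relating each state p reachable just after the innermost
-- pending call (or initially) to the states q reachable from it since, and the
-- set R ⊆ Q of currently reachable states.  A call pushes the current summary
-- together with the call letter and restarts S at the identity; a return
-- composes the saved summary, the call, S and the return transition.
module Determinize {P : PAlph} (M : VPA P) where
  open VPA M

  Rel : Set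
  Rel = Fin nQ → Fin nQ → Bool

  Pred : Set
  Pred = Fin nQ → Bool

  NS : ℕ
  NS = 2 ^ (nQ * nQ) * 2 ^ nQ

  summary : Rel → Pred → Fin NS
  summary S R = combine (codeRel S) (codePred R)

  S⟦_⟧ : Fin NS → Rel
  S⟦ s ⟧ = decodeRel (proj₁ (remQuot {2 ^ (nQ * nQ)} (2 ^ nQ) s))

  R⟦_⟧ : Fin NS → Pred
  R⟦ s ⟧ = decodePred (proj₂ (remQuot {2 ^ (nQ * nQ)} (2 ^ nQ) s))

  S-summary : ∀ S R p q → S⟦ summary S R ⟧ p q ≡ S p q
  S-summary S R p q =
    trans (cong (λ c → decodeRel c p q) (cong proj₁ (remQuot-combine {2 ^ (nQ * nQ)} (codeRel S) (codePred R))))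
          (decode-codeRel S p q)

  R-summary : ∀ S R q → R⟦ summary S R ⟧ q ≡ R q
  R-summary S R q =
    trans (cong (λ c → decodePred c q) (cong proj₂ (remQuot-combine {2 ^ (nQ * nQ)} (codeRel S) (codePred R))))
          (decode-codePred R q)

  NF : ℕ
  NF = NS * ncall P

  savedSummary : Fin NF → Fin NS
  savedSummary f = proj₁ (remQuot {NS} (ncall P) f)

  savedCall : Fin NF → Fin (ncall P)
  savedCall f = proj₂ (remQuot {NS} (ncall P) f)

  savedSummary-combine : ∀ s c → savedSummary (combine s c) ≡ s
  savedSummary-combine s c = cong proj₁ (remQuot-combine {NS} s c)

  savedCall-combine : ∀ s c → savedCall (combine s c) ≡ c
  savedCall-combine s c = cong proj₂ (remQuot-combine {NS} s c)

  intRel : Fin NS → Fin (nint P) → Rel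
  intRel s a p q' = anyFin λ q → S⟦ s ⟧ p q ∧ δi q a q'

  intReach : Fin NS → Fin (nint P) → Pred
  intReach s a q' = anyFin λ q → R⟦ s ⟧ q ∧ δi q a q'

  callReach : Fin NS → Fin (ncall P) → Pred
  callReach s c p = anyFin λ q → R⟦ s ⟧ q ∧ anyFin λ γ → δc q c p γ

  bottomRel : Fin NS → Fin (nret P) → Rel
  bottomRel s r p q' = anyFin λ q → S⟦ s ⟧ p q ∧ δr q r nothing q'

  bottomReach : Fin NS → Fin (nret P) → Pred
  bottomReach s r q' = anyFin λ q → R⟦ s ⟧ q ∧ δr q r nothing q'

  -- through the saved level: q₁ --call--> p --(S)--> q --return--> q'
  matched : Pred → Fin NS → Fin NF → Fin (nret P) → Pred
  matched before s f r q' = anyFin λ q₁ → anyFin λ p → anyFin λ q → anyFin λ γ →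
    before q₁ ∧ (δc q₁ (savedCall f) p γ ∧ (S⟦ s ⟧ p q ∧ δr q r (just γ) q'))

  matchedRel : Fin NS → Fin NF → Fin (nret P) → Rel
  matchedRel s f r p₀ = matched (S⟦ savedSummary f ⟧ p₀) s f r

  matchedReach : Fin NS → Fin NF → Fin (nret P) → Pred
  matchedReach s f r = matched R⟦ savedSummary f ⟧ s f r

  det : DVPA P
  det = record
    { nQ = NS ; nF = NF ; start = summary idRel init
    ; onCall = λ s c → summary idRel (callReach s c) , combine s c
    ; onInt = λ s a → summary (intRel s a) (intReach s a)
    ; onRet = λ { s nothing r → summary (bottomRel s r) (bottomReach s r)
                ; s (just f) r → summary (matchedRel s f r) (matchedReach s f r) }
    ; accepting = λ s → anyFin λ q → R⟦ s ⟧ q ∧ final q }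

  open DVPASemantics det using (Config; next; run; DVPAAccepts)

  S-out : ∀ S R {p q} → S⟦ summary S R ⟧ p q ≡ true → S p q ≡ true
  S-out S R {p} {q} e = trans (sym (S-summary S R p q)) e

  S-in : ∀ S R {p q} → S p q ≡ true → S⟦ summary S R ⟧ p q ≡ true
  S-in S R {p} {q} e = trans (S-summary S R p q) e

  R-out : ∀ S R {q} → R⟦ summary S R ⟧ q ≡ true → R q ≡ true
  R-out S R {q} e = trans (sym (R-summary S R q)) e

  R-in : ∀ S R {q} → R q ≡ true → R⟦ summary S R ⟧ q ≡ true
  R-in S R {q} e = trans (R-summary S R q) e

  MatchedWitness : (Fin nQ → Bool) → Fin NS → Fin NF → Fin (nret P) → Fin nQ → Set
  MatchedWitness before s f r q' = ∃[ q₁ ] ∃[ p ] ∃[ q ] ∃[ γ ]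
    (before q₁ ≡ true × δc q₁ (savedCall f) p γ ≡ true × S⟦ s ⟧ p q ≡ true × δr q r (just γ) q' ≡ true)

  matched-elim : ∀ {before s f r q'} → matched before s f r q' ≡ true → MatchedWitness before s f r q'
  matched-elim e =
    let q₁ , e₁ = anyFin-elim _ e ; p , e₂ = anyFin-elim _ e₁ ; q , e₃ = anyFin-elim _ e₂ ; γ , e₄ = anyFin-elim _ e₃
        h₁ , e₅ = ∧-elim e₄ ; h₂ , e₆ = ∧-elim e₅ ; h₃ , h₄ = ∧-elim e₆
    in q₁ , p , q , γ , h₁ , h₂ , h₃ , h₄

  matched-intro : ∀ {before s f r q'} → MatchedWitness before s f r q' → matched before s f r q' ≡ true
  matched-intro (q₁ , p , q , γ , h₁ , h₂ , h₃ , h₄) =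
    anyFin-intro _ q₁ (anyFin-intro _ p (anyFin-intro _ q (anyFin-intro _ γ
      (∧-intro h₁ (∧-intro h₂ (∧-intro h₃ h₄))))))

  Step : Fin nQ → List (Fin nΓ) → Act P → Fin nQ → List (Fin nΓ) → Set
  Step q σ (inj₁ c)        q' σ' = ∃[ γ ] (σ' ≡ γ ∷ σ × δc q c q' γ ≡ true)
  Step q σ (inj₂ (inj₁ a)) q' σ' = σ' ≡ σ × δi q a q' ≡ true
  Step q σ (inj₂ (inj₂ r)) q' σ' =
    (∃[ γ ] (σ ≡ γ ∷ σ' × δr q r (just γ) q' ≡ true)) ⊎ (σ ≡ [] × σ' ≡ [] × δr q r nothing q' ≡ true)

  run-uncons : ∀ {q σ a w q'' σ''} → VPARun M q σ (a ∷ w) q'' σ'' →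
               ∃[ q' ] ∃[ σ' ] (Step q σ a q' σ' × VPARun M q' σ' w q'' σ'')
  run-uncons (call {γ = γ} e r)   = _ , _ , (γ , refl , e) , r
  run-uncons (int e r)            = _ , _ , (refl , e) , r
  run-uncons (retPop {γ = γ} e r) = _ , _ , inj₁ (γ , refl , e) , r
  run-uncons (retBot e r)         = _ , _ , inj₂ (refl , refl , e) , r

  run-cons : ∀ {q σ} a {w q'' σ'' q' σ'} → Step q σ a q' σ' → VPARun M q' σ' w q'' σ'' → VPARun M q σ (a ∷ w) q'' σ''
  run-cons (inj₁ c)        (γ , refl , e)           r = call e r
  run-cons (inj₂ (inj₁ a)) (refl , e)               r = int e r
  run-cons (inj₂ (inj₂ b)) (inj₁ (γ , refl , e))    r = retPop e r
  run-cons (inj₂ (inj₂ b)) (inj₂ (refl , refl , e)) r = retBot e r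

  -- The VPA configurations represented by a machine configuration (s, fs):
  -- 'Base fs p σ' says that (p, σ) is reachable right after the innermost
  -- pending call recorded in fs (initial if there is none), and s relates
  -- such p to the represented states.
  mutual
    Base : List (Fin NF) → Fin nQ → List (Fin nΓ) → Set
    Base []       p σ = σ ≡ [] × init p ≡ true
    Base (f ∷ fs) p σ = ∃[ q₁ ] ∃[ σ₀ ] (Represents (savedSummary f) fs q₁ σ₀ × Step q₁ σ₀ (inj₁ (savedCall f)) p σ)

    Represents : Fin NS → List (Fin NF) → Fin nQ → List (Fin nΓ) → Set
    Represents s fs q σ = ∃[ p ] (Base fs p σ × S⟦ s ⟧ p q ≡ true)

  Repr : Config → Fin nQ → List (Fin nΓ) → Set
  Repr κ = Represents (proj₁ κ) (proj₂ κ)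

  represents-next : ∀ s fs a q'' σ'' →
    Repr (next (s , fs) a) q'' σ'' ⇔ (∃[ q ] ∃[ σ ] (Represents s fs q σ × Step q σ a q'' σ''))
  represents-next s fs (inj₂ (inj₁ a)) q'' σ'' = mk⇔
    (λ (p , b , e) → let q , e₁ = anyFin-elim _ (S-out (intRel s a) (intReach s a) e) ; g₁ , g₂ = ∧-elim e₁
                     in q , σ'' , (p , b , g₁) , (refl , g₂))
    (λ { (q , σ , (p , b , g₁) , (refl , g₂)) → p , b , S-in (intRel s a) (intReach s a) (anyFin-intro _ q (∧-intro g₁ g₂)) })
  represents-next s fs (inj₁ c) q'' σ'' = mk⇔
    (λ { (p , (q₁ , σ₀ , rep , st) , e) → sameState (idRel⇒≡ (S-out idRel (callReach s c) e)) q₁ σ₀ rep st })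
    (λ (q₁ , σ₀ , rep , st) → q'' , (q₁ , σ₀ , subst (λ s' → Represents s' fs q₁ σ₀) (sym (savedSummary-combine s c)) rep ,
                                     subst (λ c' → Step q₁ σ₀ (inj₁ c') q'' σ'') (sym (savedCall-combine s c)) st) ,
                              S-in idRel (callReach s c) (idRel-refl q''))
    where
    sameState : ∀ {p} → p ≡ q'' → ∀ q₁ σ₀ → Represents (savedSummary (combine s c)) fs q₁ σ₀ →
                Step q₁ σ₀ (inj₁ (savedCall (combine s c))) p σ'' → ∃[ q ] ∃[ σ ] (Represents s fs q σ × Step q σ (inj₁ c) q'' σ'')
    sameState refl q₁ σ₀ rep st = q₁ , σ₀ , subst (λ s' → Represents s' fs q₁ σ₀) (savedSummary-combine s c) rep ,
                                  subst (λ c' → Step q₁ σ₀ (inj₁ c') q'' σ'') (savedCall-combine s c) st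
  represents-next s [] (inj₂ (inj₂ r)) q'' σ'' = mk⇔
    (λ { (p , (refl , ip) , e) → let q , e₁ = anyFin-elim _ (S-out (bottomRel s r) (bottomReach s r) e) ; g₁ , g₂ = ∧-elim e₁ in
                                 q , [] , (p , (refl , ip) , g₁) , inj₂ (refl , refl , g₂) })
    (λ { (q , σ , (p , (refl , ip) , g₁) , inj₁ (γ , () , _))
       ; (q , σ , (p , (refl , ip) , g₁) , inj₂ (_ , refl , g₂)) → p , (refl , ip) , S-in (bottomRel s r) (bottomReach s r) (anyFin-intro _ q (∧-intro g₁ g₂)) })
  represents-next s (f ∷ fs) (inj₂ (inj₂ r)) q'' σ'' = mk⇔
    (λ (p₀ , b , e) → let q₁ , p , q , γ , h₁ , h₂ , h₃ , h₄ =
                            matched-elim {S⟦ savedSummary f ⟧ p₀} (S-out (matchedRel s f r) (matchedReach s f r) e) in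
                      q , γ ∷ σ'' , (p , (q₁ , σ'' , (p₀ , b , h₁) , (γ , refl , h₂)) , h₃) , inj₁ (γ , refl , h₄))
    (λ { (q , σ , (p , (q₁ , σ₀ , (p₀ , b , h₁) , (γ , refl , h₂)) , h₃) , inj₁ (_ , refl , h₄)) →
           p₀ , b , S-in (matchedRel s f r) (matchedReach s f r) (matched-intro {S⟦ savedSummary f ⟧ p₀} (q₁ , p , q , γ , h₁ , h₂ , h₃ , h₄))
       ; (q , σ , (p , (q₁ , σ₀ , _ , (γ , refl , _)) , _) , inj₂ (() , _)) })

  ReachSound : Fin NS → List (Fin NF) → Set
  ReachSound s fs = ∀ q → (R⟦ s ⟧ q ≡ true) ⇔ (∃[ σ ] Represents s fs q σ)

  mutual
    Valid : Fin NS → List (Fin NF) → Set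
    Valid s fs = ReachSound s fs × FramesValid fs

    FramesValid : List (Fin NF) → Set
    FramesValid []       = ⊤
    FramesValid (f ∷ fs) = Valid (savedSummary f) fs

  reach-next : ∀ s fs a → FramesValid fs → ReachSound s fs → ∀ q'' →
    (R⟦ proj₁ (next (s , fs) a) ⟧ q'' ≡ true) ⇔ (∃[ q ] ∃[ σ ] ∃[ σ'' ] (Represents s fs q σ × Step q σ a q'' σ''))
  reach-next s fs (inj₂ (inj₁ a)) _ rs q'' = mk⇔
    (λ e → let q , e₁ = anyFin-elim _ (R-out (intRel s a) (intReach s a) e) ; g₁ , g₂ = ∧-elim e₁
               σ , rep = Equivalence.to (rs q) g₁ in q , σ , σ , rep , (refl , g₂))
    (λ { (q , σ , _ , rep , (refl , g₂)) →
         R-in (intRel s a) (intReach s a) (anyFin-intro _ q (∧-intro (Equivalence.from (rs q) (σ , rep)) g₂)) })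
  reach-next s fs (inj₁ c) _ rs q'' = mk⇔
    (λ e → let q , e₁ = anyFin-elim _ (R-out idRel (callReach s c) e) ; g₁ , e₂ = ∧-elim e₁
               γ , g₂ = anyFin-elim _ e₂ ; σ , rep = Equivalence.to (rs q) g₁ in q , σ , γ ∷ σ , rep , (γ , refl , g₂))
    (λ { (q , σ , _ , rep , (γ , refl , g₂)) →
         R-in idRel (callReach s c) (anyFin-intro _ q (∧-intro (Equivalence.from (rs q) (σ , rep)) (anyFin-intro _ γ g₂))) })
  reach-next s [] (inj₂ (inj₂ r)) _ rs q'' = mk⇔
    (λ e → let q , e₁ = anyFin-elim _ (R-out (bottomRel s r) (bottomReach s r) e) ; g₁ , g₂ = ∧-elim e₁ in
           bottom q g₂ (Equivalence.to (rs q) g₁))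
    (λ { (q , _ , _ , (p , (refl , ip) , e) , inj₂ (_ , refl , g₂)) →
           R-in (bottomRel s r) (bottomReach s r)
             (anyFin-intro _ q (∧-intro (Equivalence.from (rs q) ([] , p , (refl , ip) , e)) g₂))
       ; (q , _ , _ , (p , (refl , _) , _) , inj₁ (_ , () , _)) })
    where
    bottom : ∀ q → δr q r nothing q'' ≡ true → ∃[ σ ] Represents s [] q σ →
             ∃[ q ] ∃[ σ ] ∃[ σ'' ] (Represents s [] q σ × Step q σ (inj₂ (inj₂ r)) q'' σ'')
    bottom q g₂ (_ , p , (refl , ip) , e) = q , [] , [] , (p , (refl , ip) , e) , inj₂ (refl , refl , g₂)
  reach-next s (f ∷ fs) (inj₂ (inj₂ r)) (rsf , _) rs q'' = mk⇔
    (λ e → let q₁ , p , q , γ , h₁ , h₂ , h₃ , h₄ = matched-elim {R⟦ savedSummary f ⟧} (R-out (matchedRel s f r) (matchedReach s f r) e)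
               σ₀ , rep = Equivalence.to (rsf q₁) h₁
           in q , γ ∷ σ₀ , σ₀ , (p , (q₁ , σ₀ , rep , (γ , refl , h₂)) , h₃) , inj₁ (γ , refl , h₄))
    (λ { (q , _ , _ , (p , (q₁ , σ₀ , rep , (γ , refl , h₂)) , h₃) , inj₁ (_ , refl , h₄)) →
           R-in (matchedRel s f r) (matchedReach s f r)
             (matched-intro {R⟦ savedSummary f ⟧} (q₁ , p , q , γ , Equivalence.from (rsf q₁) (σ₀ , rep) , h₂ , h₃ , h₄))
       ; (q , _ , _ , (p , (q₁ , σ₀ , _ , (γ , refl , _)) , _) , inj₂ (() , _)) })

  valid-next : ∀ s fs a → Valid s fs → Valid (proj₁ (next (s , fs) a)) (proj₂ (next (s , fs) a))
  valid-next s fs a (rs , fv) = reachSound , framesValid a fs rs fv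
    where
    reachSound : ReachSound (proj₁ (next (s , fs) a)) (proj₂ (next (s , fs) a))
    reachSound q'' = mk⇔
      (λ e → let q , σ , σ'' , rep , st = Equivalence.to (reach-next s fs a fv rs q'') e in
             σ'' , Equivalence.from (represents-next s fs a q'' σ'') (q , σ , rep , st))
      (λ (σ'' , rep'') → let q , σ , rep , st = Equivalence.to (represents-next s fs a q'' σ'') rep'' in
             Equivalence.from (reach-next s fs a fv rs q'') (q , σ , σ'' , rep , st))
    framesValid : ∀ a fs → ReachSound s fs → FramesValid fs → FramesValid (proj₂ (next (s , fs) a))
    framesValid (inj₁ c)        fs       rs fv = subst (λ s' → Valid s' fs) (sym (savedSummary-combine s c)) (rs , fv)
    framesValid (inj₂ (inj₁ _)) fs       rs fv = fv
    framesValid (inj₂ (inj₂ _)) []       rs fv = tt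
    framesValid (inj₂ (inj₂ _)) (f ∷ fs) rs fv = proj₂ fv

  represents-run : ∀ w κ q'' σ'' →
    Repr (run κ w) q'' σ'' ⇔ (∃[ q ] ∃[ σ ] (Repr κ q σ × VPARun M q σ w q'' σ''))
  represents-run []      κ q'' σ'' = mk⇔ (λ rep → q'' , σ'' , rep , nil) (λ { (_ , _ , rep , nil) → rep })
  represents-run (a ∷ w) (s , fs) q'' σ'' = mk⇔
    (λ rep → let q' , σ' , rep' , r = Equivalence.to (represents-run w (next (s , fs) a) q'' σ'') rep
                 q , σ , rep₀ , st = Equivalence.to (represents-next s fs a q' σ') rep'
             in q , σ , rep₀ , run-cons a st r)
    (λ (q , σ , rep₀ , r) → let q' , σ' , st , r' = run-uncons r in
       Equivalence.from (represents-run w (next (s , fs) a) q'' σ'')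
         (q' , σ' , Equivalence.from (represents-next s fs a q' σ') (q , σ , rep₀ , st) , r'))

  valid-run : ∀ w κ → Valid (proj₁ κ) (proj₂ κ) → Valid (proj₁ (run κ w)) (proj₂ (run κ w))
  valid-run []      κ        v = v
  valid-run (a ∷ w) (s , fs) v = valid-run w (next (s , fs) a) (valid-next s fs a v)

  start-represents : ∀ q → init q ≡ true → Represents (summary idRel init) [] q []
  start-represents q i = q , (refl , i) , S-in idRel init (idRel-refl q)

  represents-start : ∀ {p q σ} → Base [] p σ → S⟦ summary idRel init ⟧ p q ≡ true → σ ≡ [] × init q ≡ true
  represents-start {p} {q} (refl , ip) e with idRel⇒≡ {p = p} {q} (S-out idRel init e)
  ... | refl = refl , ip

  valid-start : Valid (summary idRel init) []
  valid-start = (λ q → mk⇔ (λ e → [] , start-represents q (R-out idRel init e))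
                           (λ (σ , p , b , e) → R-in idRel init (proj₂ (represents-start b e)))) , tt

  determinize-sound : ∀ w → VPAAccepts M w ⇔ DVPAAccepts w
  determinize-sound w = mk⇔
    (λ (q₀ , q , σ , i , r , f) → anyFin-intro _ q (∧-intro
       (Equivalence.from (reach q) (σ , Equivalence.from (represents-run w _ q σ) (q₀ , [] , start-represents q₀ i , r))) f))
    (λ acc → let q , e = anyFin-elim _ acc ; reachable , f = ∧-elim e
                 σ , rep = Equivalence.to (reach q) reachable
                 q₀ , σ₀ , (p , b , e₀) , r = Equivalence.to (represents-run w _ q σ) rep
                 σ₀≡[] , i = represents-start b e₀
             in q₀ , q , σ , i , subst (λ σ₀ → VPARun M q₀ σ₀ w q σ) σ₀≡[] r , f)
    where
    reach : ReachSound (proj₁ (run (summary idRel init , []) w)) (proj₂ (run (summary idRel init , []) w))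
    reach = proj₁ (valid-run w _ valid-start)

VPL≤DPDA : ∀ nAP P → LTL[VPL] nAP P ≤L LTL[DPDA] nAP P
VPL≤DPDA nAP P = LanguageTranslation.≤-by-automata VPAAccepts DPDAAccepts
  (λ M → DVPASemantics.asDPDA (Determinize.det M))
  (λ M w → ⇔.trans (Determinize.determinize-sound M w) (DVPASemantics.asDPDA-sound (Determinize.det M) w))

Stream : Set → Set
Stream A = ℕ → A

_∷ₛ_ : ∀ {A} → A → Stream A → Stream A
(a ∷ₛ t) zero    = a
(a ∷ₛ t) (suc i) = t i

pad : ∀ {A} → A → ℕ → Stream A → Stream A
pad x zero    t = t
pad x (suc m) t = x ∷ₛ pad x m t

pad-drop : ∀ {A} (x : A) m t i → pad x m t (i + m) ≡ t i
pad-drop x zero    t i = cong t (+-identityʳ i)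
pad-drop x (suc m) t i rewrite +-suc i m = pad-drop x m t i

pad-+ : ∀ {A} (x : A) m n t i → pad x (m + n) t i ≡ pad x m (pad x n t) i
pad-+ x zero    n t i       = refl
pad-+ x (suc m) n t zero    = refl
pad-+ x (suc m) n t (suc i) = pad-+ x m n t i

pad-suffix : ∀ {A} (x : A) {j d a} t → j + d ≡ a → ∀ i → pad x a t (i + j) ≡ pad x d t i
pad-suffix x {j} {d} t refl i = trans (pad-+ x j d t (i + j)) (pad-drop x j (pad x d t) i)

pad-suffix-+ : ∀ {A} (x : A) P a t j i → pad x (P + a) t (i + (P + j)) ≡ pad x a t (i + j)
pad-suffix-+ x P a t j i = begin
  pad x (P + a) t (i + (P + j))     ≡⟨ pad-+ x P a t (i + (P + j)) ⟩
  pad x P (pad x a t) (i + (P + j)) ≡⟨ cong (pad x P (pad x a t)) (i+[P+j]≡[i+j]+P) ⟩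
  pad x P (pad x a t) (i + j + P)   ≡⟨ pad-drop x P (pad x a t) (i + j) ⟩
  pad x a t (i + j)                 ∎
  where
  open ≡-Reasoning
  i+[P+j]≡[i+j]+P : i + (P + j) ≡ i + j + P
  i+[P+j]≡[i+j]+P = trans (cong (i +_) (+-comm P j)) (sym (+-assoc i j P))

applyUpTo-cong : ∀ {A : Set} {f g : ℕ → A} → (∀ i → f i ≡ g i) → ∀ n → applyUpTo f n ≡ applyUpTo g n
applyUpTo-cong h zero    = refl
applyUpTo-cong h (suc n) = cong₂ _∷_ (h 0) (applyUpTo-cong (h ∘ suc) n)

replicate-++ : ∀ {A : Set} (x : A) m n (u : List A) → replicate (m + n) x ++ u ≡ replicate m x ++ (replicate n x ++ u)
replicate-++ x zero    n u = refl
replicate-++ x (suc m) n u = cong (x ∷_) (replicate-++ x m n u)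

prefix-pad-short : ∀ {A} (x : A) n d t → applyUpTo (pad x (n + d) t) n ≡ replicate n x
prefix-pad-short x zero    d t = refl
prefix-pad-short x (suc n) d t = cong (x ∷_) (prefix-pad-short x n d t)

prefix-pad-long : ∀ {A} (x : A) m n t → applyUpTo (pad x m t) (m + n) ≡ replicate m x ++ applyUpTo t n
prefix-pad-long x zero    n t = refl
prefix-pad-long x (suc m) n t = cong (x ∷_) (prefix-pad-long x m n t)

prefix-pad-≤ : ∀ {A} (x : A) {n a} t → n ≤ a → applyUpTo (pad x a t) n ≡ replicate n x
prefix-pad-≤ x t n≤a with m≤n⇒∃[o]m+o≡n n≤a
... | d , refl = prefix-pad-short x _ d t

prefix-pad-block : ∀ {A} (x : A) {T₀ n a} t → T₀ ≤ n → T₀ ≤ a →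
  ∃[ b ] ∃[ u ] (T₀ ≤ b × applyUpTo (pad x a t) n ≡ replicate b x ++ u)
prefix-pad-block x {n = n} {a} t T₀≤n T₀≤a with n ≤? a
... | yes n≤a = n , [] , T₀≤n , trans (prefix-pad-≤ x t n≤a) (sym (++-identityʳ _))
... | no n≰a with m≤n⇒∃[o]m+o≡n (≰⇒≥ n≰a)
...   | e , refl = a , applyUpTo t e , T₀≤a , prefix-pad-long x a e t

Periodic : ℕ → ℕ → (ℕ → Set) → Set
Periodic T P Φ = ∀ m → P ∣ m → ∀ b → T ≤ b → Φ b ⇔ Φ (m + b)

periodic-from-step : ∀ {T P Φ} → (∀ b → T ≤ b → Φ b ⇔ Φ (P + b)) → Periodic T P Φ
periodic-from-step {T} {P} {Φ} step m (divides q refl) b T≤b = go q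
  where
  go : ∀ q → Φ b ⇔ Φ (q * P + b)
  go zero    = ⇔.refl
  go (suc q) rewrite +-assoc P (q * P) b = ⇔.trans (go q) (step (q * P + b) (≤-trans T≤b (m≤n+m b (q * P))))

periodic-weaken : ∀ {T T' P P' Φ} → T ≤ T' → P ∣ P' → Periodic T P Φ → Periodic T' P' Φ
periodic-weaken T≤T' P∣P' per m P'∣m b T'≤b = per m (∣-trans P∣P' P'∣m) b (≤-trans T≤T' T'≤b)

UniformlyPeriodic : {I : Set} → (I → ℕ → Set) → Set
UniformlyPeriodic Φ = ∃[ T ] ∃[ P ] (0 < P × (∀ i → Periodic T P (Φ i)))

module Pumping {AP A Aut : Set} (Lang : Aut → List A → Set) (x : A) where

  -- The system with one state, every transition and no true proposition;
  -- every infinite word is the action sequence of one of its paths.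
  streamKTS : KTS AP A
  streamKTS = record { S = ⊤ ; _⟶[_]_ = λ _ _ _ → ⊤ ; label = λ _ _ → false ; s₀ = tt ; total = λ _ → x , tt , tt }

  streamPath : Stream A → Path streamKTS
  streamPath f = record { st = λ _ → tt ; act = f ; step = λ _ → tt }

  sem : LTLUForm AP Aut → Stream A → Set
  sem ψ f = satU Lang (streamPath f) ψ

  sem-≗ : ∀ {f g} → (∀ i → f i ≡ g i) → ∀ ψ → sem ψ f ⇔ sem ψ g
  sem-≗ f≗g ψ = mk⇔ (satU-transfer Lang (agree (sameLabels λ _ _ → refl) f≗g) ψ)
                    (satU-transfer Lang (agree (sameLabels λ _ _ → refl) (sym ∘ f≗g)) ψ)

  LanguagePeriodic : Aut → Set
  LanguagePeriodic 𝒜 = UniformlyPeriodic (λ u b → Lang 𝒜 (replicate b x ++ u))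

  FormulaPeriodic : LTLUForm AP Aut → Set
  FormulaPeriodic ψ = UniformlyPeriodic (λ t a → sem ψ (pad x a t))

  -- Assume ψ, χ and 𝒜 are periodic with common threshold T₀
  -- and period P.  A witness position k < K₀ stays put (everything up to it
  -- sees only x's, and the suffixes there are pumped by the hypotheses); a
  -- witness k ≥ K₀ moves to P + k (and back), its suffix being unchanged.
  module UntilStep (ψ χ : LTLUForm AP Aut) (𝒜 : Aut) (T₀ P : ℕ)
         (ψ-per : ∀ t → Periodic T₀ P (λ a → sem ψ (pad x a t)))
         (χ-per : ∀ t → Periodic T₀ P (λ a → sem χ (pad x a t)))
         (𝒜-per : ∀ u → Periodic T₀ P (λ b → Lang 𝒜 (replicate b x ++ u))) where

    K₀ T : ℕ
    K₀ = P + T₀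
    T  = K₀ + T₀

    split-below : ∀ {j a} → j < K₀ → T ≤ a → ∃[ d ] (j + d ≡ a × T₀ ≤ d)
    split-below {j} {a} j<K₀ T≤a with m≤n⇒∃[o]m+o≡n (≤-trans (<⇒≤ j<K₀) (≤-trans (m≤m+n K₀ T₀) T≤a))
    ... | d , j+d≡a = d , j+d≡a ,
      +-cancelˡ-≤ j T₀ d (≤-trans (+-monoˡ-≤ T₀ (<⇒≤ j<K₀)) (≤-trans T≤a (≤-reflexive (sym j+d≡a))))

    small-position : ∀ {φ} → (∀ t → Periodic T₀ P (λ a → sem φ (pad x a t))) → ∀ t a j → j < K₀ → T ≤ a →
      satU Lang (streamPath (pad x a t) ↑ j) φ ⇔ satU Lang (streamPath (pad x (P + a) t) ↑ j) φ
    small-position {φ} per t a j j<K₀ T≤a with split-below j<K₀ T≤a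
    ... | d , j+d≡a , T₀≤d =
      ⇔.trans (sem-≗ (pad-suffix x t j+d≡a) φ)
        (⇔.trans (per t P ∣-refl d T₀≤d) (sem-≗ (sym ∘ pad-suffix x t j+[P+d]≡P+a) φ))
      where
      j+[P+d]≡P+a : j + (P + d) ≡ P + a
      j+[P+d]≡P+a = trans (+-comm j (P + d)) (trans (+-assoc P d j) (cong (P +_) (trans (+-comm d j) j+d≡a)))

    large-position : ∀ φ t a j →
      satU Lang (streamPath (pad x a t) ↑ j) φ ⇔ satU Lang (streamPath (pad x (P + a) t) ↑ (P + j)) φ
    large-position φ t a j = sem-≗ (sym ∘ pad-suffix-+ x P a t j) φ

    small-prefix : ∀ t a k → k < K₀ → T ≤ a →
      Actions (streamPath (pad x a t)) k ≡ Actions (streamPath (pad x (P + a) t)) k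
    small-prefix t a k k<K₀ T≤a = begin
      Actions (streamPath (pad x a t)) k       ≡⟨ Actions≡applyUpTo (streamPath (pad x a t)) k ⟩
      applyUpTo (pad x a t) (suc k)            ≡⟨ prefix-pad-≤ x t k<a ⟩
      replicate (suc k) x                      ≡⟨ prefix-pad-≤ x t (≤-trans k<a (m≤n+m a P)) ⟨
      applyUpTo (pad x (P + a) t) (suc k)      ≡⟨ Actions≡applyUpTo (streamPath (pad x (P + a) t)) k ⟨
      Actions (streamPath (pad x (P + a) t)) k ∎
      where
      open ≡-Reasoning
      k<a : k < a
      k<a = <-≤-trans k<K₀ (≤-trans (m≤m+n K₀ T₀) T≤a)

    large-prefix : ∀ t a k → T₀ ≤ k → T₀ ≤ a →
      Lang 𝒜 (Actions (streamPath (pad x a t)) k) ⇔ Lang 𝒜 (Actions (streamPath (pad x (P + a) t)) (P + k))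
    large-prefix t a k T₀≤k T₀≤a with prefix-pad-block x t (≤-trans T₀≤k (n≤1+n k)) T₀≤a
    ... | b , u , T₀≤b , blocks = mk⇔
      (λ l → subst (Lang 𝒜) (sym pumped) (Equivalence.to (𝒜-per u P ∣-refl b T₀≤b) (subst (Lang 𝒜) original l)))
      (λ l → subst (Lang 𝒜) (sym original) (Equivalence.from (𝒜-per u P ∣-refl b T₀≤b) (subst (Lang 𝒜) pumped l)))
      where
      open ≡-Reasoning
      original : Actions (streamPath (pad x a t)) k ≡ replicate b x ++ u
      original = trans (Actions≡applyUpTo (streamPath (pad x a t)) k) blocks
      pumped : Actions (streamPath (pad x (P + a) t)) (P + k) ≡ replicate (P + b) x ++ u
      pumped = begin
        Actions (streamPath (pad x (P + a) t)) (P + k)   ≡⟨ Actions≡applyUpTo (streamPath (pad x (P + a) t)) (P + k) ⟩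
        applyUpTo (pad x (P + a) t) (suc (P + k))        ≡⟨ cong (applyUpTo (pad x (P + a) t)) (+-suc P k) ⟨
        applyUpTo (pad x (P + a) t) (P + suc k)          ≡⟨ applyUpTo-cong (pad-+ x P a t) (P + suc k) ⟩
        applyUpTo (pad x P (pad x a t)) (P + suc k)      ≡⟨ prefix-pad-long x P (suc k) (pad x a t) ⟩
        replicate P x ++ applyUpTo (pad x a t) (suc k)   ≡⟨ cong (replicate P x ++_) blocks ⟩
        replicate P x ++ (replicate b x ++ u)            ≡⟨ replicate-++ x P b u ⟨
        replicate (P + b) x ++ u                         ∎

    U : LTLUForm AP Aut
    U = until ψ 𝒜 χ

    forward : ∀ t a → T ≤ a → sem U (pad x a t) → sem U (pad x (P + a) t)
    forward t a T≤a (k , s , u , l) with k <? K₀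
    ... | yes k<K₀ =
      k , Equivalence.to (small-position χ-per t a k k<K₀ T≤a) s ,
      (λ j j<k → Equivalence.to (small-position ψ-per t a j (<-trans j<k k<K₀) T≤a) (u j j<k)) ,
      subst (Lang 𝒜) (small-prefix t a k k<K₀ T≤a) l
    ... | no k≮K₀ =
      P + k , Equivalence.to (large-position χ t a k) s , before ,
      Equivalence.to (large-prefix t a k (≤-trans (m≤n+m T₀ P) K₀≤k) (≤-trans (m≤n+m T₀ K₀) T≤a)) l
      where
      K₀≤k : K₀ ≤ k
      K₀≤k = ≮⇒≥ k≮K₀
      before : ∀ j → j < P + k → satU Lang (streamPath (pad x (P + a) t) ↑ j) ψ
      before j j<P+k with j <? P
      ... | yes j<P = Equivalence.to (small-position ψ-per t a j (<-≤-trans j<P (m≤m+n P T₀)) T≤a)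
                        (u j (<-≤-trans j<P (≤-trans (m≤m+n P T₀) K₀≤k)))
      ... | no j≮P with m≤n⇒∃[o]m+o≡n (≮⇒≥ j≮P)
      ...   | j' , refl = Equivalence.to (large-position ψ t a j') (u j' (+-cancelˡ-< P j' k j<P+k))

    backward : ∀ t a → T ≤ a → sem U (pad x (P + a) t) → sem U (pad x a t)
    backward t a T≤a (k , s , u , l) with k <? K₀
    ... | yes k<K₀ =
      k , Equivalence.from (small-position χ-per t a k k<K₀ T≤a) s ,
      (λ j j<k → Equivalence.from (small-position ψ-per t a j (<-trans j<k k<K₀) T≤a) (u j j<k)) ,
      subst (Lang 𝒜) (sym (small-prefix t a k k<K₀ T≤a)) l
    ... | no k≮K₀ with m≤n⇒∃[o]m+o≡n (≤-trans (m≤m+n P T₀) (≮⇒≥ k≮K₀))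
    ...   | k' , refl =
      k' , Equivalence.from (large-position χ t a k') s ,
      (λ j j<k' → Equivalence.from (large-position ψ t a j) (u (P + j) (+-monoʳ-< P j<k'))) ,
      Equivalence.from (large-prefix t a k' (+-cancelˡ-≤ P T₀ k' (≮⇒≥ k≮K₀)) (≤-trans (m≤n+m T₀ K₀) T≤a)) l

    until-periodic : ∀ t → Periodic T P (λ a → sem U (pad x a t))
    until-periodic t = periodic-from-step λ a T≤a → mk⇔ (forward t a T≤a) (backward t a T≤a)

  formula-periodic : (∀ 𝒜 → LanguagePeriodic 𝒜) → ∀ ψ → FormulaPeriodic ψ
  formula-periodic LP (atom p) = 0 , 1 , s≤s z≤n , λ t m _ b _ → ⇔.refl
  formula-periodic LP (¬ᵤ ψ) =
    let T , P , P>0 , per = formula-periodic LP ψ in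
    T , P , P>0 , λ t m P∣m b T≤b → ¬-cong-⇔ (per t m P∣m b T≤b)
  formula-periodic LP (ψ ∧ᵤ χ) =
    let T₁ , P₁ , P₁>0 , per₁ = formula-periodic LP ψ
        T₂ , P₂ , P₂>0 , per₂ = formula-periodic LP χ
    in T₁ + T₂ , P₁ * P₂ , *-mono-< P₁>0 P₂>0 , λ t m P∣m b T≤b →
       periodic-weaken (m≤m+n T₁ T₂) (m∣m*n P₂) (per₁ t) m P∣m b T≤b ×-⇔
       periodic-weaken (m≤n+m T₂ T₁) (n∣m*n P₁) (per₂ t) m P∣m b T≤b
  formula-periodic LP (until ψ 𝒜 χ) =
    let T₁ , P₁ , P₁>0 , per₁ = formula-periodic LP ψ
        T₂ , P₂ , P₂>0 , per₂ = formula-periodic LP χ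
        T₃ , P₃ , P₃>0 , per₃ = LP 𝒜
        T₀ = T₁ + T₂ + T₃
        P  = P₁ * P₂ * P₃
        open UntilStep ψ χ 𝒜 T₀ P
               (λ t → periodic-weaken (≤-trans (m≤m+n T₁ T₂) (m≤m+n (T₁ + T₂) T₃)) (∣-trans (m∣m*n P₂) (m∣m*n P₃)) (per₁ t))
               (λ t → periodic-weaken (≤-trans (m≤n+m T₂ T₁) (m≤m+n (T₁ + T₂) T₃)) (∣-trans (n∣m*n P₁) (m∣m*n P₃)) (per₂ t))
               (λ u → periodic-weaken (m≤n+m T₃ (T₁ + T₂)) (n∣m*n (P₁ * P₂)) (per₃ u))
    in T , P , *-mono-< (*-mono-< P₁>0 P₂>0) P₃>0 , until-periodic

-- Powers of a Boolean relation E on Fin n are ultimately periodic: there are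
-- only 2^(n·n) relations, so two powers coincide (pigeonhole), and from then
-- on the sequence repeats.
module RelationPower {n : ℕ} (E : Fin n → Fin n → Bool) where

  power : ℕ → Fin n → Fin n → Bool
  power zero    q q' = idRel q q'
  power (suc b) q q' = anyFin λ q₁ → E q q₁ ∧ power b q₁ q'

  SamePower : ℕ → ℕ → Set
  SamePower i j = ∀ q q' → power i q q' ≡ power j q q'

  samePower-+ : ∀ {i j} → SamePower i j → ∀ t → SamePower (t + i) (t + j)
  samePower-+ same zero    = same
  samePower-+ same (suc t) q q' = anyFin-cong λ q₁ → cong (E q q₁ ∧_) (samePower-+ same t q₁ q')

  repeated-power : ∃[ i ] ∃[ j ] (i < j × SamePower i j)
  repeated-power with pigeonhole (n<1+n (2 ^ (n * n))) (λ i → codeRel (power (toℕ i)))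
  ... | i , j , i<j , same = toℕ i , toℕ j , i<j , λ q q' →
    trans (sym (decode-codeRel (power (toℕ i)) q q'))
          (trans (cong (λ c → decodeRel c q q') same) (decode-codeRel (power (toℕ j)) q q'))

  power-periodic : ∃[ T ] ∃[ P ] (0 < P × (∀ b → T ≤ b → SamePower b (P + b)))
  power-periodic with repeated-power
  ... | i , j , i<j , same with m≤n⇒∃[o]m+o≡n i<j
  ...   | P' , refl = i , suc P' , s≤s z≤n , λ b i≤b → from-i b i≤b
    where
    from-i : ∀ b → i ≤ b → SamePower b (suc P' + b)
    from-i b i≤b with m≤n⇒∃[o]m+o≡n i≤b
    ... | t , refl = λ q q' → begin
      power (i + t) q q'                ≡⟨ cong (λ m → power m q q') (+-comm i t) ⟩
      power (t + i) q q'                ≡⟨ samePower-+ same t q q' ⟩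
      power (t + (suc i + P')) q q'     ≡⟨ cong (λ m → power m q q') (rearrange t i P') ⟩
      power (suc P' + (i + t)) q q'     ∎
      where
      open ≡-Reasoning
      rearrange : ∀ t i p → t + (suc i + p) ≡ suc p + (i + t)
      rearrange = solve-∀

  -- Consequently any machine reading x through E accepts x^b u periodically in b.
  module _ {A : Set} (x : A) (L : List A → Set) (init : Fin n → Bool) (Acc : Fin n → List A → Set)
           (Acc-x : ∀ q w → Acc q (x ∷ w) ⇔ (∃[ q' ] (E q q' ≡ true × Acc q' w)))
           (L-Acc : ∀ w → L w ⇔ (∃[ q ] (init q ≡ true × Acc q w))) where

    Acc-power : ∀ b q u → Acc q (replicate b x ++ u) ⇔ (∃[ q' ] (power b q q' ≡ true × Acc q' u))
    Acc-power zero q u = mk⇔ (λ acc → q , idRel-refl q , acc)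
                             (λ (q' , e , acc) → subst (λ q → Acc q u) (sym (idRel⇒≡ e)) acc)
    Acc-power (suc b) q u = mk⇔
      (λ acc → let q₁ , e₁ , acc₁ = Equivalence.to (Acc-x q _) acc
                   q' , e₂ , acc' = Equivalence.to (Acc-power b q₁ u) acc₁
               in q' , anyFin-intro _ q₁ (∧-intro e₁ e₂) , acc')
      (λ (q' , e , acc') → let q₁ , e₁ = anyFin-elim _ e ; e₂ , e₃ = ∧-elim e₁ in
         Equivalence.from (Acc-x q _) (q₁ , e₂ , Equivalence.from (Acc-power b q₁ u) (q' , e₃ , acc')))

    letter-periodic : UniformlyPeriodic (λ u b → L (replicate b x ++ u))
    letter-periodic with power-periodic
    ... | T , P , P>0 , per = T , P , P>0 , λ u → periodic-from-step λ b T≤b → mk⇔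
      (λ l → let q , i , acc = Equivalence.to (L-Acc _) l
                 q' , e , acc' = Equivalence.to (Acc-power b q u) acc
             in Equivalence.from (L-Acc _)
                  (q , i , Equivalence.from (Acc-power (P + b) q u) (q' , trans (sym (per b T≤b q q')) e , acc')))
      (λ l → let q , i , acc = Equivalence.to (L-Acc _) l
                 q' , e , acc' = Equivalence.to (Acc-power (P + b) q u) acc
             in Equivalence.from (L-Acc _)
                  (q , i , Equivalence.from (Acc-power b q u) (q' , trans (per b T≤b q q') e , acc')))

nfa-periodic : ∀ {A : Set} (x : A) (N : NFA A) → UniformlyPeriodic (λ u b → NFAAccepts N (replicate b x ++ u))
nfa-periodic x N = RelationPower.letter-periodic (λ q q' → NFA.δ N q x q') x (NFAAccepts N) (NFA.init N) Acc Acc-x L-Acc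
  where
  Acc : Fin (NFA.nQ N) → List _ → Set
  Acc q w = ∃[ q' ] (NFARun N q w q' × NFA.final N q' ≡ true)
  Acc-x : ∀ q w → Acc q (x ∷ w) ⇔ (∃[ q₁ ] (NFA.δ N q x q₁ ≡ true × Acc q₁ w))
  Acc-x q w = mk⇔ (λ { (q' , cons e r , f) → _ , e , q' , r , f }) (λ (q₁ , e , q' , r , f) → q' , cons e r , f)
  L-Acc : ∀ w → NFAAccepts N w ⇔ (∃[ q ] (NFA.init N q ≡ true × Acc q w))
  L-Acc w = mk⇔ (λ (q , q' , i , r , f) → q , i , q' , r , f) (λ (q , i , q' , r , f) → q , q' , i , r , f)

-- VPAs have ultimately periodic languages on a prefix of returns: unmatched
-- returns read on the empty stack act like an NFA letter.
vpa-periodic : ∀ {P} (r₀ : Fin (nret P)) (M : VPA P) →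
  UniformlyPeriodic (λ u b → VPAAccepts M (replicate b (inj₂ (inj₂ r₀)) ++ u))
vpa-periodic {P} r₀ M =
  RelationPower.letter-periodic (λ q q' → VPA.δr M q r₀ nothing q') (inj₂ (inj₂ r₀)) (VPAAccepts M) (VPA.init M) Acc Acc-x L-Acc
  where
  Acc : Fin (VPA.nQ M) → List (Act P) → Set
  Acc q w = ∃[ q' ] ∃[ σ ] (VPARun M q [] w q' σ × VPA.final M q' ≡ true)
  Acc-x : ∀ q w → Acc q (inj₂ (inj₂ r₀) ∷ w) ⇔ (∃[ q₁ ] (VPA.δr M q r₀ nothing q₁ ≡ true × Acc q₁ w))
  Acc-x q w = mk⇔ (λ { (q' , σ , retBot e r , f) → _ , e , q' , σ , r , f }) (λ (q₁ , e , q' , σ , r , f) → q' , σ , retBot e r , f)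
  L-Acc : ∀ w → VPAAccepts M w ⇔ (∃[ q ] (VPA.init M q ≡ true × Acc q w))
  L-Acc w = mk⇔ (λ (q , q' , σ , i , r , f) → q , i , q' , σ , r , f) (λ (q , i , q' , σ , r , f) → q , q' , σ , i , r , f)

lineKTS : ∀ {AP A : Set} → Stream A → KTS AP A
lineKTS f = record
  { S = ℕ ; _⟶[_]_ = λ i a j → j ≡ suc i × a ≡ f i ; label = λ _ _ → false ; s₀ = 0
  ; total = λ i → f i , suc i , refl , refl }

linePath : ∀ {AP A : Set} (f : Stream A) → Path (lineKTS {AP} f)
linePath f = record { st = id ; act = f ; step = λ i → refl , refl }

line-actions : ∀ {AP A : Set} {f : Stream A} (π : Path (lineKTS {AP} f)) → st π 0 ≡ 0 → ∀ i → act π i ≡ f i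
line-actions {f = f} π st₀ i = trans (proj₂ (step π i)) (cong f (position i))
  where
  position : ∀ i → st π i ≡ i
  position zero    = st₀
  position (suc i) = trans (proj₁ (step π i)) (cong suc (position i))

module Separation {AP A Aut : Set} (Lang : Aut → List A → Set) (x : A) where
  open Pumping {AP} Lang x

  line-⊨ : ∀ {Aut'} (Lang' : Aut' → List A → Set) f ψ →
    (lineKTS f ⊨[ LTL[ Lang' ] ] ψ) ⇔ satU Lang' (streamPath f) ψ
  line-⊨ Lang' f ψ = mk⇔
    (λ h → satU-transfer Lang' (agree (sameLabels λ _ _ → refl) λ _ → refl) ψ (h (linePath f) refl))
    (λ s π st₀ → satU-transfer Lang' (agree (sameLabels λ _ _ → refl) (sym ∘ line-actions π st₀)) ψ s)

  not-expressible : (∀ 𝒜 → LanguagePeriodic 𝒜) →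
    ∀ {Aut'} (Lang' : Aut' → List A → Set) (φ : LTLUForm AP Aut') →
    (∀ T P → 0 < P → ∃[ a ] ∃[ t ] (T ≤ a × satU Lang' (streamPath (pad x a t)) φ ×
                                         ¬ satU Lang' (streamPath (pad x (P + a) t)) φ)) →
    ¬ (LTL[ Lang' ] ≤L LTL[ Lang ])
  not-expressible LP Lang' φ aperiodic = not-≤L φ λ ψ →
    let T , P , P>0 , per = formula-periodic LP ψ
        a , t , T≤a , holds , fails = aperiodic T P P>0
    in lineKTS (pad x a t) , lineKTS (pad x (P + a) t) ,
       (λ ⊨ψ → Equivalence.from (line-⊨ Lang (pad x (P + a) t) ψ)
                 (Equivalence.to (per t P ∣-refl a T≤a) (Equivalence.to (line-⊨ Lang (pad x a t) ψ) ⊨ψ))) ,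
       Equivalence.from (line-⊨ Lang' (pad x a t) φ) holds ,
       λ ⊨φ → fails (Equivalence.to (line-⊨ Lang' (pad x (P + a) t) φ) ⊨φ)

  balanced-not-expressible : (∀ 𝒜 → LanguagePeriodic 𝒜) →
    ∀ {Aut'} (Lang' : Aut' → List A → Set) (p₀ : AP) (y z : A) (𝒜 : Aut') →
    (∀ n → Lang' 𝒜 (replicate (suc n) x ++ (replicate (suc n) y ++ z ∷ []))) →
    (∀ n b → 0 < b → b < n → ∀ m → ¬ Lang' 𝒜 (applyUpTo (pad x n (pad y b (λ _ → z))) m)) →
    ¬ (LTL[ Lang' ] ≤L LTL[ Lang ])
  balanced-not-expressible LP Lang' p₀ y z 𝒜 balanced unbalanced = not-expressible LP Lang' someAccepted aperiodic
    where
    someAccepted : LTLUForm AP _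
    someAccepted = until (⊤ᵤ p₀) 𝒜 (⊤ᵤ p₀)
    zs : Stream A
    zs _ = z
    aperiodic : ∀ T P → 0 < P → ∃[ a ] ∃[ t ] (T ≤ a × satU Lang' (streamPath (pad x a t)) someAccepted ×
                                               ¬ satU Lang' (streamPath (pad x (P + a) t)) someAccepted)
    aperiodic T P P>0 = suc T , pad y (suc T) zs , n≤1+n T , holds , fails
      where
      a : ℕ
      a = suc T
      word : Actions (streamPath (pad x a (pad y a zs))) (a + a) ≡ replicate a x ++ (replicate a y ++ z ∷ [])
      word = begin
        Actions (streamPath (pad x a (pad y a zs))) (a + a)   ≡⟨ Actions≡applyUpTo (streamPath (pad x a (pad y a zs))) (a + a) ⟩
        applyUpTo (pad x a (pad y a zs)) (suc (a + a))        ≡⟨ cong (applyUpTo (pad x a (pad y a zs))) (+-suc a a) ⟨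
        applyUpTo (pad x a (pad y a zs)) (a + suc a)          ≡⟨ prefix-pad-long x a (suc a) (pad y a zs) ⟩
        replicate a x ++ applyUpTo (pad y a zs) (suc a)       ≡⟨ cong (λ n → replicate a x ++ applyUpTo (pad y a zs) n) (+-comm 1 a) ⟩
        replicate a x ++ applyUpTo (pad y a zs) (a + 1)       ≡⟨ cong (replicate a x ++_) (prefix-pad-long y a 1 zs) ⟩
        replicate a x ++ (replicate a y ++ z ∷ [])            ∎
        where open ≡-Reasoning
      holds : satU Lang' (streamPath (pad x a (pad y a zs))) someAccepted
      holds = a + a , ⊤ᵤ-sat Lang' (streamPath (pad x a (pad y a zs)) ↑ (a + a)) p₀ ,
              (λ j _ → ⊤ᵤ-sat Lang' (streamPath (pad x a (pad y a zs)) ↑ j) p₀) , subst (Lang' 𝒜) (sym word) (balanced T)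
      fails : ¬ satU Lang' (streamPath (pad x (P + a) (pad y a zs))) someAccepted
      fails (k , _ , _ , l) = unbalanced (P + a) a (s≤s z≤n) (+-monoˡ-≤ a P>0) (suc k)
        (subst (Lang' 𝒜) (Actions≡applyUpTo (streamPath (pad x (P + a) (pad y a zs))) k) l)

prefix-shape : ∀ {A : Set} (x y z : A) n b m →
  let w = applyUpTo (pad x n (pad y b (λ _ → z))) m in
  (∃[ m' ] (m' ≤ n × w ≡ replicate m' x)) ⊎
  (∃[ j ] (j ≤ b × w ≡ replicate n x ++ replicate j y)) ⊎
  (∃[ u ] (w ≡ replicate n x ++ (replicate b y ++ z ∷ u)))
prefix-shape x y z n b m with m ≤? n
... | yes m≤n = inj₁ (m , m≤n , prefix-pad-≤ x _ m≤n)
... | no m≰n with m≤n⇒∃[o]m+o≡n (≰⇒≥ m≰n)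
...   | e , refl with e ≤? b
...     | yes e≤b = inj₂ (inj₁ (e , e≤b , trans (prefix-pad-long x n e _) (cong (replicate n x ++_) (prefix-pad-≤ y _ e≤b))))
...     | no e≰b with m≤n⇒∃[o]m+o≡n (≰⇒> e≰b)
...       | f , refl = inj₂ (inj₂ (applyUpTo (λ _ → z) f , (begin
  applyUpTo (pad x n (pad y b zs)) (n + suc (b + f))        ≡⟨ prefix-pad-long x n (suc (b + f)) _ ⟩
  replicate n x ++ applyUpTo (pad y b zs) (suc (b + f))     ≡⟨ cong (λ k → replicate n x ++ applyUpTo (pad y b zs) k) (+-suc b f) ⟨
  replicate n x ++ applyUpTo (pad y b zs) (b + suc f)       ≡⟨ cong (replicate n x ++_) (prefix-pad-long y b (suc f) zs) ⟩
  replicate n x ++ (replicate b y ++ z ∷ applyUpTo zs f)    ∎)))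
  where
  open ≡-Reasoning
  zs : Stream _
  zs _ = z

replicate-snoc : ∀ {A : Set} (c : A) m (σ : List A) → c ∷ (replicate m c ++ σ) ≡ replicate m c ++ (c ∷ σ)
replicate-snoc c zero    σ = refl
replicate-snoc c (suc m) σ = cong (c ∷_) (replicate-snoc c m σ)

-- A VPA for { c^n r^n i | n ≥ 1 } (c a call, r a return, i an internal
-- letter): the first call pushes a bottom mark B, further calls push C, and
-- the return popping B leads to the state expecting i.
module BalancedVPA {P : PAlph} (c₀ : Fin (ncall P)) (i₀ : Fin (nint P)) (r₀ : Fin (nret P)) where
  x y z : Act P
  x = inj₁ c₀
  y = inj₂ (inj₂ r₀)
  z = inj₂ (inj₁ i₀)

  B C : Fin 2
  B = zero
  C = suc zero

  counting : Fin 4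
  counting = suc zero

  onCall : Fin 4 → Fin (ncall P) → Fin 4 → Fin 2 → Bool
  onCall zero       _ (suc zero) zero       = true
  onCall (suc zero) _ (suc zero) (suc zero) = true
  onCall _          _ _          _          = false

  onRet : Fin 4 → Fin (nret P) → Maybe (Fin 2) → Fin 4 → Bool
  onRet (suc zero) _ (just (suc zero)) (suc zero)       = true
  onRet (suc zero) _ (just zero)       (suc (suc zero)) = true
  onRet _          _ _                 _                = false

  onInt : Fin 4 → Fin (nint P) → Fin 4 → Bool
  onInt (suc (suc zero)) _ (suc (suc (suc zero))) = true
  onInt _                _ _                      = false

  V : VPA P
  V = record { nQ = 4 ; nΓ = 2 ; init = λ { zero → true ; _ → false }
             ; final = λ { (suc (suc (suc zero))) → true ; _ → false }
             ; δc = onCall ; δi = onInt ; δr = onRet }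

  calls : ∀ m {σ w q σ'} → VPARun V counting (replicate m C ++ σ) w q σ' → VPARun V counting σ (replicate m x ++ w) q σ'
  calls zero    r = r
  calls (suc m) {σ} {w} {q} {σ'} r =
    call refl (calls m {C ∷ σ} (subst (λ s → VPARun V counting s w q σ') (replicate-snoc C m σ) r))

  returns : ∀ m {σ w q σ'} → VPARun V counting σ w q σ' → VPARun V counting (replicate m C ++ σ) (replicate m y ++ w) q σ'
  returns zero    r = r
  returns (suc m) r = retPop refl (returns m r)

  balanced : ∀ n → VPAAccepts V (replicate (suc n) x ++ (replicate (suc n) y ++ z ∷ []))
  balanced n = zero , suc (suc (suc zero)) , [] , refl ,
    call {γ = B} refl (calls n (subst (λ w → VPARun V counting (replicate n C ++ B ∷ []) w _ [])
                                      (sym (replicate-snoc y n (z ∷ [])))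
                                      (returns n (retPop refl (int refl nil))))) , refl

  calls⁻¹ : ∀ m {σ w q σ'} → VPARun V counting σ (replicate m x ++ w) q σ' → VPARun V counting (replicate m C ++ σ) w q σ'
  calls⁻¹ zero    r = r
  calls⁻¹ (suc m) {σ} {w} {q} {σ'} (call {q' = suc zero} {γ = suc zero} _ r) =
    subst (λ s → VPARun V counting s w q σ') (sym (replicate-snoc C m σ)) (calls⁻¹ m r)
  calls⁻¹ (suc m) (call {q' = zero} () _)
  calls⁻¹ (suc m) (call {q' = suc zero} {γ = zero} () _)
  calls⁻¹ (suc m) (call {q' = suc (suc _)} () _)

  returns⁻¹ : ∀ m d {σ w q σ'} → VPARun V counting (replicate (m + d) C ++ σ) (replicate m y ++ w) q σ' →
              VPARun V counting (replicate d C ++ σ) w q σ'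
  returns⁻¹ zero    d r = r
  returns⁻¹ (suc m) d (retPop {q' = suc zero} _ r) = returns⁻¹ m d r
  returns⁻¹ (suc m) d (retPop {q' = zero} () _)
  returns⁻¹ (suc m) d (retPop {q' = suc (suc _)} () _)

  first-call⁻¹ : ∀ {w q σ'} → VPARun V zero [] (x ∷ w) q σ' → VPARun V counting (B ∷ []) w q σ'
  first-call⁻¹ (call {q' = suc zero} {γ = zero} _ r) = r
  first-call⁻¹ (call {q' = zero} () _)
  first-call⁻¹ (call {q' = suc zero} {γ = suc zero} () _)
  first-call⁻¹ (call {q' = suc (suc _)} () _)

  counting-not-final : ∀ {σ q σ'} → VPARun V counting σ [] q σ' → VPA.final V q ≡ true → ⊥
  counting-not-final nil ()

  counting-no-internal : ∀ {σ w q σ'} → ¬ VPARun V counting σ (z ∷ w) q σ'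
  counting-no-internal (int {q' = zero} () _)
  counting-no-internal (int {q' = suc _} () _)

  unbalanced : ∀ n b → 0 < b → b < n → ∀ m → ¬ VPAAccepts V (applyUpTo (pad x n (pad y b (λ _ → z))) m)
  unbalanced n b _ b<n m acc with prefix-shape x y z n b m
  unbalanced n b _ b<n m (zero , q , σ , _ , r , f) | inj₁ (m' , _ , eq) rewrite eq = only-calls m' r f
    where
    only-calls : ∀ m' {q σ} → VPARun V zero [] (replicate m' x) q σ → VPA.final V q ≡ true → ⊥
    only-calls zero    nil ()
    only-calls (suc m') r f = counting-not-final
      (calls⁻¹ m' (subst (λ w → VPARun V counting (B ∷ []) w _ _) (sym (++-identityʳ (replicate m' x))) (first-call⁻¹ r))) f
  unbalanced (suc n') b _ (s≤s b≤n') m (zero , q , σ , _ , r , f) | inj₂ (inj₁ (j , j≤b , eq)) rewrite eq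
    with m≤n⇒∃[o]m+o≡n (≤-trans j≤b b≤n')
  ... | d , refl = counting-not-final (returns⁻¹ j d (subst (λ w → VPARun V counting (replicate (j + d) C ++ B ∷ []) w _ _)
                      (sym (++-identityʳ (replicate j y))) (calls⁻¹ (j + d) (first-call⁻¹ r)))) f
  unbalanced (suc n') b _ (s≤s b≤n') m (zero , q , σ , _ , r , f) | inj₂ (inj₂ (w , eq)) rewrite eq
    with m≤n⇒∃[o]m+o≡n b≤n'
  ... | d , refl = counting-no-internal (returns⁻¹ b d (calls⁻¹ (b + d) (first-call⁻¹ r)))
  unbalanced n b _ b<n m (suc _ , _ , _ , () , _) | _

-- A DPDA for { r^n c^n i | n ≥ 1 } (r a return, c a call, i an internal
-- letter): returns push a counter C, calls pop it, and i is read on the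
-- bottom symbol.  Its language is not visibly pushdown.
module CountingDPDA {P : PAlph} (c₀ : Fin (ncall P)) (i₀ : Fin (nint P)) (r₀ : Fin (nret P)) where
  x y z : Act P
  x = inj₂ (inj₂ r₀)
  y = inj₁ c₀
  z = inj₂ (inj₁ i₀)

  Z C : Fin 2
  Z = zero
  C = suc zero

  popping : Fin 3
  popping = suc zero

  onLetter : Fin 3 → Act P → Fin 2 → Maybe (Fin 3 × List (Fin 2))
  onLetter zero       (inj₂ (inj₂ _)) X          = just (zero , C ∷ X ∷ [])
  onLetter zero       (inj₁ _)        (suc zero) = just (popping , [])
  onLetter (suc zero) (inj₁ _)        (suc zero) = just (popping , [])
  onLetter (suc zero) (inj₂ (inj₁ _)) zero       = just (suc (suc zero) , zero ∷ [])
  onLetter _          _               _          = nothing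

  transition : Fin 3 → Maybe (Act P) → Fin 2 → Maybe (Fin 3 × List (Fin 2))
  transition q nothing  X = nothing
  transition q (just a) X = onLetter q a X

  D : DPDA (Act P)
  D = record { nQ = 3 ; nΓ = 2 ; q₀ = zero ; Z₀ = Z ; final = λ { (suc (suc zero)) → true ; _ → false }
             ; δ = transition ; det = λ _ _ ε-move _ → ⊥-elim (ε-move refl) }

  returns : ∀ m {X σ w q σ'} → DPDARun D zero w (replicate m C ++ X ∷ σ) q σ' → DPDARun D zero (replicate m x ++ w) (X ∷ σ) q σ'
  returns zero    r = r
  returns (suc m) {X} {σ} {w} {q} {σ'} r =
    read refl (returns m {C} {X ∷ σ} (subst (λ s → DPDARun D zero w s q σ') (replicate-snoc C m (X ∷ σ)) r))

  calls : ∀ m {σ w q σ'} → DPDARun D popping w σ q σ' → DPDARun D popping (replicate m y ++ w) (replicate m C ++ σ) q σ'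
  calls zero    r = r
  calls (suc m) r = read refl (calls m r)

  balanced : ∀ n → DPDAAccepts D (replicate (suc n) x ++ (replicate (suc n) y ++ z ∷ []))
  balanced n = suc (suc zero) , Z ∷ [] , returns (suc n) {Z} {[]} (read refl (calls n (read refl nil))) , refl

  returns⁻¹ : ∀ m {X σ w q σ'} → DPDARun D zero (replicate m x ++ w) (X ∷ σ) q σ' → DPDARun D zero w (replicate m C ++ X ∷ σ) q σ'
  returns⁻¹ zero    r = r
  returns⁻¹ (suc m) (eps () _)
  returns⁻¹ (suc m) {X} {σ} {w} {q} {σ'} (read refl r) =
    subst (λ s → DPDARun D zero w s q σ') (sym (replicate-snoc C m (X ∷ σ))) (returns⁻¹ m {C} {X ∷ σ} r)

  calls⁻¹ : ∀ m d {σ w q σ'} → DPDARun D popping (replicate m y ++ w) (replicate (m + d) C ++ σ) q σ' →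
            DPDARun D popping w (replicate d C ++ σ) q σ'
  calls⁻¹ zero    d r = r
  calls⁻¹ (suc m) d (eps () _)
  calls⁻¹ (suc m) d (read refl r) = calls⁻¹ m d r

  first-call⁻¹ : ∀ {σ w q σ'} → DPDARun D zero (y ∷ w) (C ∷ σ) q σ' → DPDARun D popping w σ q σ'
  first-call⁻¹ (eps () _)
  first-call⁻¹ (read refl r) = r

  initial-not-final : ∀ {σ q σ'} → DPDARun D zero [] σ q σ' → DPDA.final D q ≡ true → ⊥
  initial-not-final nil ()
  initial-not-final (eps () _) _

  popping-not-final : ∀ {σ q σ'} → DPDARun D popping [] σ q σ' → DPDA.final D q ≡ true → ⊥
  popping-not-final nil ()
  popping-not-final (eps () _) _

  popping-no-internal : ∀ {σ w q σ'} → ¬ DPDARun D popping (z ∷ w) (C ∷ σ) q σ'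
  popping-no-internal (eps () _)
  popping-no-internal (read () _)

  unbalanced : ∀ n b → 0 < b → b < n → ∀ m → ¬ DPDAAccepts D (applyUpTo (pad x n (pad y b (λ _ → z))) m)
  unbalanced n b _ b<n m acc with prefix-shape x y z n b m
  unbalanced n b _ b<n m (q , σ , r , f) | inj₁ (m' , _ , eq) rewrite eq =
    initial-not-final (returns⁻¹ m' {Z} {[]} (subst (λ w → DPDARun D zero w _ _ _) (sym (++-identityʳ (replicate m' x))) r)) f
  unbalanced n b _ b<n m (q , σ , r , f) | inj₂ (inj₁ (zero , _ , eq)) rewrite eq =
    initial-not-final (returns⁻¹ n {Z} {[]} r) f
  unbalanced (suc n') b _ (s≤s b≤n') m (q , σ , r , f) | inj₂ (inj₁ (suc j , j<b , eq)) rewrite eq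
    with m≤n⇒∃[o]m+o≡n (≤-trans (<⇒≤ j<b) b≤n')
  ... | d , refl = popping-not-final (calls⁻¹ j d (first-call⁻¹ (returns⁻¹ (suc (j + d)) {Z} {[]}
        (subst (λ w → DPDARun D zero w (Z ∷ []) q σ) (cong (replicate (suc (j + d)) x ++_) (sym (++-identityʳ (replicate (suc j) y)))) r)))) f
  unbalanced (suc n') (suc b') _ (s≤s b≤n') m (q , σ , r , f) | inj₂ (inj₂ (w , eq)) rewrite eq
    with m≤n⇒∃[o]m+o≡n (≤-trans (n≤1+n b') b≤n')
  ... | suc d , refl = popping-no-internal (calls⁻¹ b' (suc d) (first-call⁻¹ (returns⁻¹ (suc (b' + suc d)) {Z} {[]} r)))
  ... | zero , e = ⊥-elim (1+n≰n (≤-trans b≤n' (≤-reflexive (trans (sym e) (+-identityʳ b')))))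

VPL≰REG : ∀ {nAP P} → Fin nAP → Fin (ncall P) → Fin (nint P) → Fin (nret P) → ¬ (LTL[VPL] nAP P ≤L LTL[REG] nAP P)
VPL≰REG p₀ c i r =
  Separation.balanced-not-expressible NFAAccepts x (nfa-periodic x) VPAAccepts p₀ y z V balanced unbalanced
  where open BalancedVPA c i r

DPDA≰VPL : ∀ {nAP P} → Fin nAP → Fin (ncall P) → Fin (nint P) → Fin (nret P) → ¬ (LTL[DPDA] nAP P ≤L LTL[VPL] nAP P)
DPDA≰VPL p₀ c i r =
  Separation.balanced-not-expressible VPAAccepts x (vpa-periodic r) DPDAAccepts p₀ y z D balanced unbalanced
  where open CountingDPDA c i r

mainTheorem19 : (nAP : ℕ) (P : PAlph) →
    0 < nAP → 0 < ncall P → 0 < nint P → 0 < nret P →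
    (LTLₗ nAP P <L LTL[REG] nAP P) ×
    (LTL[REG] nAP P <L LTL[VPL] nAP P) ×
    (LTL[VPL] nAP P <L LTL[DPDA] nAP P)
mainTheorem19 nAP P 0<nAP 0<ncall 0<nint 0<nret =
  (LTL-into-REG.LTL≤REG p₀ , REG≰LTL p₀ c i) ,
  (REG≤VPL nAP P , VPL≰REG p₀ c i r) ,
  (VPL≤DPDA nAP P , DPDA≰VPL p₀ c i r)
  where
  p₀ : Fin nAP
  p₀ = fromℕ< 0<nAP
  c : Fin (ncall P)
  c = fromℕ< 0<ncall
  i : Fin (nint P)
  i = fromℕ< 0<nint
  r : Fin (nret P)
  r = fromℕ< 0<nret
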